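{- Let $\ell\geq 1$ be an integer, let $\xi\in\mathbb{R}$ and $h\in\mathbb{R}\setminus\{0\}$, and let $x_i=\xi+ih$ for $i=0,1,\ldots,\ell$. Let $\mathbf{a}=(a_0,\ldots,a_\ell)\in\mathbb{R}^{\ell+1}$ and let $q_{\mathbf{a}}$ be the unique polynomial of degree at most $\ell$ with $q_{\mathbf{a}}(x_i)=a_i$ for $i=0,\ldots,\ell$. For an integer $s\geq 0$ let $A_{s,\mathbf{a}}\in M_{\ell+1}(\mathbb{R})$ be the matrix \[ A_{s,\mathbf{a}}=\begin{pmatrix} 1^{\ell-1} & 2^{\ell-1}&\cdots& (\ell+1)^{\ell-1}\\ (\ell+2)^{\ell-1} & (\ell+3)^{\ell-1}&\cdots& (2\ell+2)^{\ell-1}\\ \vdots &\vdots &&\vdots \\ (\ell^{2})^{\ell-1} & (\ell^{2}+1)^{\ell-1} &\cdots& (\ell^2+\ell)^{\ell-1}\\ 0^sa_0 &1^sa_1&\cdots &\ell^sa_\ell \end{pmatrix}, \] i.e. $(A_{s,\mathbf{a}})_{ij}=\big((i-1)(\ell+1)+j\big)^{\ell-1}$ for $1\leq i\leq \ell$, $1\leq j\leq \ell+1$, and $(A_{s,\mathbf{a}})_{\ell+1,j}=(j-1)^s a_{j-1}$ for $1\le j\le \ell+1$. Then for an integer $m$ with $0\le m\le \ell$, the polynomial $q_{\mathbf{a}}$ has degree $\ell-m$ if and only if $\det A_{s,\mathbf{a}}=0$ for $s=0,\ldots,m-1$ and $\det A_{m,\mathbf{a}}\neq 0$.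
   Context: The convention $0^0=1$ is used. -}

module Defs where

open import Level using (Level; _⊔_) renaming (suc to lsuc)
open import Data.Nat as ℕ using (ℕ; zero; suc)
open import Data.Fin using (Fin; toℕ; fromℕ<; punchIn)
import Data.Fin as F
open import Data.Product using (∃; _×_)
open import Relation.Nullary using (¬_; yes; no)
open import Relation.Binary.PropositionalEquality using (_≡_)
open import Relation.Binary.Structures using (IsTotalOrder)
open import Algebra.Bundles using (CommutativeRing)

-- The real numbers, axiomatised (up to isomorphism) as a Dedekind-complete
-- ordered field: a commutative ring with 0 ≠ 1 and inverses of nonzero
-- elements, a total order compatible with + and *, and the least upper
-- bound property.
record RealField (c r : Level) : Set (lsuc (c ⊔ r)) where
  field
    commutativeRing : CommutativeRing c r
  open CommutativeRing commutativeRing public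
  field
    _≤_           : Carrier → Carrier → Set r
    ≤-isTotalOrder : IsTotalOrder _≈_ _≤_
    0≉1           : ¬ (0# ≈ 1#)
    inverse       : ∀ x → ¬ (x ≈ 0#) → ∃ λ y → (x * y) ≈ 1#
    +-mono-≤      : ∀ {x y} z → x ≤ y → (x + z) ≤ (y + z)
    *-nonneg      : ∀ {x y} → 0# ≤ x → 0# ≤ y → 0# ≤ (x * y)
    lub           : (S : Carrier → Set r) → ∃ S →
                    (∃ λ b → ∀ x → S x → x ≤ b) →
                    ∃ λ s → (∀ x → S x → x ≤ s) ×
                            (∀ b → (∀ x → S x → x ≤ b) → s ≤ b)

module RealDefs {c r : Level} (R : RealField c r) where
  open RealField R

  ι : ℕ → Carrier
  ι zero    = 0#
  ι (suc n) = 1# + ι n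

  -- powers, with x ^ 0 = 1 (so 0 ^ 0 = 1)
  _^_ : Carrier → ℕ → Carrier
  x ^ zero  = 1#
  x ^ suc n = x * (x ^ n)

  Σ : ∀ {n} → (Fin n → Carrier) → Carrier
  Σ {zero}  f = 0#
  Σ {suc n} f = f F.zero + Σ (λ i → f (F.suc i))

  alt : ℕ → Carrier → Carrier
  alt zero    x = x
  alt (suc k) x = - alt k x

  Matrix : ℕ → Set c
  Matrix n = Fin n → Fin n → Carrier

  det : ∀ {n} → Matrix n → Carrier
  det {zero}  M = 1#
  det {suc n} M =
    Σ (λ j → alt (toℕ j) (M F.zero j * det (λ i k → M (F.suc i) (punchIn j k))))

  eval : ∀ {ℓ} → (Fin (suc ℓ) → Carrier) → Carrier → Carrier
  eval p x = Σ (λ k → p k * (x ^ toℕ k))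

  HasDegree : ∀ {ℓ} → (Fin (suc ℓ) → Carrier) → ℕ → Set r
  HasDegree {ℓ} p d =
    (∀ k → toℕ k ≡ d → ¬ (p k ≈ 0#)) × (∀ k → d ℕ.< toℕ k → p k ≈ 0#)

  -- the matrix A_{s,a} (0-based indices): rows i < ℓ have entries
  -- (i(ℓ+1) + j + 1)^(ℓ-1), the last row (i = ℓ) has entries j^s a_j
  -- (with the convention 0^0 = 1)
  A : (ℓ s : ℕ) → (Fin (suc ℓ) → Carrier) → Matrix (suc ℓ)
  A ℓ s a i j with toℕ i ℕ.≟ ℓ
  ... | yes _ = ι (toℕ j ℕ.^ s) * a j
  ... | no  _ = ι ((toℕ i ℕ.* suc ℓ ℕ.+ toℕ j ℕ.+ 1) ℕ.^ (ℓ ℕ.∸ 1))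

-- Write ℓ = N + 1, Q y = q (ξ + y h), so that a t = Q t, and P y = y ^ N. Row m < ℓ of A samples P at
-- consecutive integers starting from the node m (ℓ + 1) + 1, the last row samples y ^ s Q y at 0, …, ℓ.
-- Column operations replace column j by its (ℓ - j)-th finite difference without changing det A; this kills
-- column 0 of the upper rows, as ℓ-th differences annihilate polynomials of degree < ℓ. Expanding along
-- column 0, det A_s = ± K Δ^ℓ (y ^ s Q) (0), where K is a generalised Vandermonde determinant (column k
-- holds a polynomial of exact degree k evaluated at the distinct nodes), hence K ≠ 0. If the coefficients
-- of q above degree ℓ - s vanish, y ^ s Q y has degree ≤ ℓ and its ℓ-th difference is ± ℓ! times its top
-- coefficient q (ℓ - s) h ^ (ℓ - s). Induction on s then reads the degree of q off the first nonzero det A_s.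

module Submission where

open import Defs
open import Level using (Level; _⊔_)
open import Data.Nat using (ℕ; zero; suc; _<_; _∸_) renaming (_≤_ to _≤ℕ_)
open import Data.Fin using (Fin; toℕ)
open import Data.Product using (_×_)
open import Relation.Nullary using (¬_)
open import Function.Bundles using (_⇔_)

import Data.Nat as ℕ
import Data.Nat.Properties as ℕP
open import Data.Integer as ℤ using (ℤ; +_; -[1+_])
import Data.Integer.Properties as ℤP
open import Data.Sign as Sign using (Sign)
open import Data.Maybe using (Maybe; just; nothing)
open import Data.Fin as F using (zero; suc; punchIn; punchOut; inject₁; fromℕ; fromℕ<)
import Data.Fin.Properties as FP
open import Data.Product using (∃; _,_; proj₁; proj₂)
open import Data.Sum using (_⊎_; inj₁; inj₂)
open import Data.Empty using (⊥-elim)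
open import Function using (_∘_)
open import Function.Bundles using (mk⇔; module Equivalence)
open import Relation.Nullary using (yes; no; Dec)
open import Relation.Binary using (tri<; tri≈; tri>)
open import Relation.Binary.PropositionalEquality as PE using (_≡_; _≢_)
open import Relation.Binary.Structures using (IsTotalOrder)
open import Algebra.Bundles using (RawRing)
import Algebra.Solver.Ring.AlmostCommutativeRing as ACR

module _ {c r : Level} (R : RealField c r) where
  open RealField R hiding (zero)
  open RealDefs R
  open import Relation.Binary.Reasoning.Setoid setoid
  open import Algebra.Properties.Ring ring
    using (-0#≈0#; -‿involutive; -‿+-comm; -‿distribˡ-*; -‿distribʳ-*; -1*x≈-x)
  open import Algebra.Properties.Group +-group using (inverseʳ-unique)

  ι-+ : ∀ m n → ι (m ℕ.+ n) ≈ ι m + ι n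
  ι-+ zero   n = sym (+-identityˡ _)
  ι-+ (suc m) n = trans (+-congˡ (ι-+ m n)) (sym (+-assoc _ _ _))

  ι-* : ∀ m n → ι (m ℕ.* n) ≈ ι m * ι n
  ι-* zero   n = sym (zeroˡ _)
  ι-* (suc m) n = begin
    ι (n ℕ.+ m ℕ.* n)     ≈⟨ ι-+ n (m ℕ.* n) ⟩
    ι n + ι (m ℕ.* n)     ≈⟨ +-cong (sym (*-identityˡ _)) (ι-* m n) ⟩
    1# * ι n + ι m * ι n  ≈⟨ sym (distribʳ _ _ _) ⟩
    (1# + ι m) * ι n      ∎

  ^-cong : ∀ k {x y} → x ≈ y → x ^ k ≈ y ^ k
  ^-cong zero   e = refl
  ^-cong (suc k) e = *-cong e (^-cong k e)

  ι-^ : ∀ m k → ι (m ℕ.^ k) ≈ ι m ^ k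
  ι-^ m zero   = +-identityʳ 1#
  ι-^ m (suc k) = trans (ι-* m (m ℕ.^ k)) (*-congˡ (ι-^ m k))

  -- Integers as coefficients for the ring solver.

  ⟦_⟧ℤ : ℤ → Carrier
  ⟦ + n ⟧ℤ      = ι n
  ⟦ -[1+ n ] ⟧ℤ = - ι (suc n)

  ⟦⊖⟧ : ∀ m n → ⟦ m ℤ.⊖ n ⟧ℤ ≈ ι m - ι n
  ⟦⊖⟧ zero    zero    = sym (trans (+-congˡ -0#≈0#) (+-identityʳ _))
  ⟦⊖⟧ (suc m) zero    = sym (trans (+-congˡ -0#≈0#) (+-identityʳ _))
  ⟦⊖⟧ zero    (suc n) = sym (+-identityˡ _)
  ⟦⊖⟧ (suc m) (suc n) = begin
    ⟦ suc m ℤ.⊖ suc n ⟧ℤ   ≡⟨ PE.cong ⟦_⟧ℤ (ℤP.[1+m]⊖[1+n]≡m⊖n m n) ⟩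
    ⟦ m ℤ.⊖ n ⟧ℤ           ≈⟨ ⟦⊖⟧ m n ⟩
    ι m - ι n              ≈⟨ sym (cancel-1 (ι m) (ι n)) ⟩
    ι (suc m) - ι (suc n)  ∎
    where
    cancel-1 : ∀ a b → (1# + a) - (1# + b) ≈ a - b
    cancel-1 a b = begin
      (1# + a) + - (1# + b)    ≈⟨ +-congˡ (sym (-‿+-comm 1# b)) ⟩
      (1# + a) + (- 1# + - b)  ≈⟨ +-assoc 1# a _ ⟩
      1# + (a + (- 1# + - b))  ≈⟨ +-congˡ (sym (+-assoc a _ _)) ⟩
      1# + ((a + - 1#) + - b)  ≈⟨ +-congˡ (+-congʳ (+-comm a _)) ⟩
      1# + ((- 1# + a) + - b)  ≈⟨ +-congˡ (+-assoc _ a _) ⟩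
      1# + (- 1# + (a + - b))  ≈⟨ sym (+-assoc 1# _ _) ⟩
      (1# + - 1#) + (a + - b)  ≈⟨ +-congʳ (-‿inverseʳ 1#) ⟩
      0# + (a - b)             ≈⟨ +-identityˡ _ ⟩
      a - b                    ∎

  ⟦-⟧ : ∀ i → ⟦ ℤ.- i ⟧ℤ ≈ - ⟦ i ⟧ℤ
  ⟦-⟧ -[1+ n ]  = sym (-‿involutive _)
  ⟦-⟧ (+ zero)  = sym -0#≈0#
  ⟦-⟧ (+ suc n) = refl

  ⟦+⟧ : ∀ i j → ⟦ i ℤ.+ j ⟧ℤ ≈ ⟦ i ⟧ℤ + ⟦ j ⟧ℤ
  ⟦+⟧ -[1+ m ] -[1+ n ] = begin
    - ι (suc (suc (m ℕ.+ n)))   ≡⟨ PE.cong (λ k → - ι (suc k)) (PE.sym (ℕP.+-suc m n)) ⟩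
    - ι (suc m ℕ.+ suc n)       ≈⟨ -‿cong (ι-+ (suc m) (suc n)) ⟩
    - (ι (suc m) + ι (suc n))   ≈⟨ sym (-‿+-comm _ _) ⟩
    - ι (suc m) + - ι (suc n)   ∎
  ⟦+⟧ -[1+ m ] (+ n)    = trans (⟦⊖⟧ n (suc m)) (+-comm _ _)
  ⟦+⟧ (+ m)    -[1+ n ] = ⟦⊖⟧ m (suc n)
  ⟦+⟧ (+ m)    (+ n)    = ι-+ m n

  ⟦_⟧± : Sign → Carrier
  ⟦ Sign.+ ⟧± = 1#
  ⟦ Sign.- ⟧± = - 1#

  ⟦*⟧± : ∀ s t → ⟦ s Sign.* t ⟧± ≈ ⟦ s ⟧± * ⟦ t ⟧±
  ⟦*⟧± Sign.- Sign.- = sym (trans (-1*x≈-x (- 1#)) (-‿involutive 1#))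
  ⟦*⟧± Sign.- Sign.+ = sym (*-identityʳ _)
  ⟦*⟧± Sign.+ _      = sym (*-identityˡ _)

  ⟦◃⟧ : ∀ s n → ⟦ s ℤ.◃ n ⟧ℤ ≈ ⟦ s ⟧± * ι n
  ⟦◃⟧ s      zero    = sym (zeroʳ _)
  ⟦◃⟧ Sign.- (suc n) = sym (-1*x≈-x _)
  ⟦◃⟧ Sign.+ (suc n) = sym (*-identityˡ _)

  ⟦sign◃∣∣⟧ : ∀ i → ⟦ i ⟧ℤ ≈ ⟦ ℤ.sign i ⟧± * ι ℤ.∣ i ∣
  ⟦sign◃∣∣⟧ i = trans (reflexive (PE.cong ⟦_⟧ℤ (PE.sym (ℤP.◃-inverse i)))) (⟦◃⟧ (ℤ.sign i) ℤ.∣ i ∣)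

  ⟦*⟧ : ∀ i j → ⟦ i ℤ.* j ⟧ℤ ≈ ⟦ i ⟧ℤ * ⟦ j ⟧ℤ
  ⟦*⟧ i j = begin
    ⟦ (si Sign.* sj) ℤ.◃ (ai ℕ.* aj) ⟧ℤ  ≈⟨ ⟦◃⟧ (si Sign.* sj) (ai ℕ.* aj) ⟩
    ⟦ si Sign.* sj ⟧± * ι (ai ℕ.* aj)    ≈⟨ *-cong (⟦*⟧± si sj) (ι-* ai aj) ⟩
    (⟦ si ⟧± * ⟦ sj ⟧±) * (ι ai * ι aj)  ≈⟨ middleFour _ _ _ _ ⟩
    (⟦ si ⟧± * ι ai) * (⟦ sj ⟧± * ι aj)  ≈⟨ *-cong (sym (⟦sign◃∣∣⟧ i)) (sym (⟦sign◃∣∣⟧ j)) ⟩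
    ⟦ i ⟧ℤ * ⟦ j ⟧ℤ                      ∎
    where
    si sj : Sign
    si = ℤ.sign i
    sj = ℤ.sign j
    ai aj : ℕ
    ai = ℤ.∣ i ∣
    aj = ℤ.∣ j ∣
    middleFour : ∀ a b x y → (a * b) * (x * y) ≈ (a * x) * (b * y)
    middleFour a b x y = begin
      (a * b) * (x * y)  ≈⟨ *-assoc a b _ ⟩
      a * (b * (x * y))  ≈⟨ *-congˡ (sym (*-assoc b x y)) ⟩
      a * ((b * x) * y)  ≈⟨ *-congˡ (*-congʳ (*-comm b x)) ⟩
      a * ((x * b) * y)  ≈⟨ *-congˡ (*-assoc x b y) ⟩
      a * (x * (b * y))  ≈⟨ sym (*-assoc a x _) ⟩
      (a * x) * (b * y)  ∎

  ℤ-rawRing : RawRing _ _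
  ℤ-rawRing = record
    { Carrier = ℤ ; _≈_ = _≡_ ; _+_ = ℤ._+_ ; _*_ = ℤ._*_ ; -_ = ℤ.-_ ; 0# = + 0 ; 1# = + 1 }

  ℤ⟶R : ACR._-Raw-AlmostCommutative⟶_ ℤ-rawRing (ACR.fromCommutativeRing commutativeRing)
  ℤ⟶R = record
    { ⟦_⟧ = ⟦_⟧ℤ ; +-homo = ⟦+⟧ ; *-homo = ⟦*⟧ ; -‿homo = ⟦-⟧ ; 0-homo = refl ; 1-homo = +-identityʳ 1# }

  ⟦⟧-≟ : ∀ i j → Maybe (⟦ i ⟧ℤ ≈ ⟦ j ⟧ℤ)
  ⟦⟧-≟ i j with i ℤ.≟ j
  ... | yes PE.refl = just refl
  ... | no _        = nothing

  open import Algebra.Solver.Ring ℤ-rawRing (ACR.fromCommutativeRing commutativeRing) ℤ⟶R ⟦⟧-≟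
    using (solve; _:+_; _:*_; _:-_; :-_; _:=_; con)

  1≉0 : ¬ (1# ≈ 0#)
  1≉0 e = 0≉1 (sym e)

  *-cancelˡ-≉0 : ∀ {x y} → ¬ (x ≈ 0#) → x * y ≈ 0# → y ≈ 0#
  *-cancelˡ-≉0 {x} {y} x≉0 xy≈0 with inverse x x≉0
  ... | x⁻¹ , xx⁻¹≈1 = begin
    y               ≈⟨ sym (*-identityˡ y) ⟩
    1# * y          ≈⟨ *-congʳ (sym xx⁻¹≈1) ⟩
    (x * x⁻¹) * y   ≈⟨ *-congʳ (*-comm _ _) ⟩
    (x⁻¹ * x) * y   ≈⟨ *-assoc _ _ _ ⟩
    x⁻¹ * (x * y)   ≈⟨ *-congˡ xy≈0 ⟩
    x⁻¹ * 0#        ≈⟨ zeroʳ _ ⟩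
    0#              ∎

  *-cancelʳ-≉0 : ∀ {x y} → ¬ (y ≈ 0#) → x * y ≈ 0# → x ≈ 0#
  *-cancelʳ-≉0 y≉0 xy≈0 = *-cancelˡ-≉0 y≉0 (trans (*-comm _ _) xy≈0)

  *-≉0 : ∀ {x y} → ¬ (x ≈ 0#) → ¬ (y ≈ 0#) → ¬ (x * y ≈ 0#)
  *-≉0 x≉0 y≉0 xy≈0 = y≉0 (*-cancelˡ-≉0 x≉0 xy≈0)

  -‿≉0 : ∀ {x} → ¬ (x ≈ 0#) → ¬ (- x ≈ 0#)
  -‿≉0 {x} x≉0 -x≈0 = x≉0 (trans (sym (-‿involutive x)) (trans (-‿cong -x≈0) -0#≈0#))

  ^-≉0 : ∀ {x} k → ¬ (x ≈ 0#) → ¬ (x ^ k ≈ 0#)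
  ^-≉0 zero   x≉0 = 1≉0
  ^-≉0 (suc k) x≉0 = *-≉0 x≉0 (^-≉0 k x≉0)

  open IsTotalOrder ≤-isTotalOrder using (antisym; total; ≤-resp-≈)
    renaming (trans to ≤-trans; reflexive to ≤-reflexive)

  0≤1 : 0# ≤ 1#
  0≤1 with total 0# 1#
  ... | inj₁ 0≤1′ = 0≤1′
  ... | inj₂ 1≤0  = proj₁ ≤-resp-≈ (trans (-1*x≈-x (- 1#)) (-‿involutive 1#)) (*-nonneg 0≤-1 0≤-1)
    where
    0≤-1 : 0# ≤ (- 1#)
    0≤-1 = proj₂ ≤-resp-≈ (-‿inverseʳ 1#) (proj₁ ≤-resp-≈ (+-identityˡ _) (+-mono-≤ (- 1#) 1≤0))

  1≤1+ι : ∀ n → 1# ≤ ι (suc n)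
  0≤ι : ∀ n → 0# ≤ ι n

  1≤1+ι n = proj₂ ≤-resp-≈ (+-identityˡ 1#) (proj₁ ≤-resp-≈ (+-comm (ι n) 1#) (+-mono-≤ 1# (0≤ι n)))

  0≤ι zero   = ≤-reflexive refl
  0≤ι (suc n) = ≤-trans 0≤1 (1≤1+ι n)

  ι-suc≉0 : ∀ n → ¬ (ι (suc n) ≈ 0#)
  ι-suc≉0 n ι≈0 = 0≉1 (antisym 0≤1 (proj₁ ≤-resp-≈ ι≈0 (1≤1+ι n)))

  ι-diff≉0 : ∀ {m n} → m < n → ¬ (ι n - ι m ≈ 0#)
  ι-diff≉0 {m} {n} m<n diff≈0 with n ∸ m | ℕP.m+[n∸m]≡n (ℕP.<⇒≤ m<n) | ℕP.m<n⇒0<n∸m m<n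
  ... | suc d | m+d≡n | _ = ι-suc≉0 d (begin
    ι (suc d)                   ≈⟨ sym (solve 2 (λ a b → (a :+ b) :- a := b) refl (ι m) (ι (suc d))) ⟩
    (ι m + ι (suc d)) - ι m     ≈⟨ +-congʳ (sym (ι-+ m (suc d))) ⟩
    ι (m ℕ.+ suc d) - ι m       ≡⟨ PE.cong (λ k → ι k - ι m) m+d≡n ⟩
    ι n - ι m                   ≈⟨ diff≈0 ⟩
    0#                          ∎)

  Σ-cong : ∀ {n} {f g : Fin n → Carrier} → (∀ i → f i ≈ g i) → Σ f ≈ Σ g
  Σ-cong {zero}  f≈g = refl
  Σ-cong {suc n} f≈g = +-cong (f≈g zero) (Σ-cong (f≈g ∘ suc))

  Σ-0 : ∀ {n} (f : Fin n → Carrier) → (∀ i → f i ≈ 0#) → Σ f ≈ 0#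
  Σ-0 {zero}  f f≈0 = refl
  Σ-0 {suc n} f f≈0 = trans (+-cong (f≈0 zero) (Σ-0 _ (f≈0 ∘ suc))) (+-identityʳ 0#)

  Σ-+ : ∀ {n} (f g : Fin n → Carrier) → Σ (λ i → f i + g i) ≈ Σ f + Σ g
  Σ-+ {zero}  f g = sym (+-identityʳ 0#)
  Σ-+ {suc n} f g = trans (+-congˡ (Σ-+ (f ∘ suc) (g ∘ suc)))
    (solve 4 (λ a b x y → (a :+ b) :+ (x :+ y) := (a :+ x) :+ (b :+ y)) refl _ _ _ _)

  Σ-* : ∀ {n} a (f : Fin n → Carrier) → Σ (λ i → a * f i) ≈ a * Σ f
  Σ-* {zero}  a f = sym (zeroʳ a)
  Σ-* {suc n} a f = trans (+-congˡ (Σ-* a (f ∘ suc))) (sym (distribˡ _ _ _))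

  Σ-single : ∀ {n} (f : Fin n → Carrier) t → (∀ j → j ≢ t → f j ≈ 0#) → Σ f ≈ f t
  Σ-single {suc n} f zero    f≈0 = trans (+-congˡ (Σ-0 _ (λ j → f≈0 (suc j) (λ ())))) (+-identityʳ _)
  Σ-single {suc n} f (suc t) f≈0 =
    trans (+-cong (f≈0 zero (λ ())) (Σ-single (f ∘ suc) t (λ j j≢t → f≈0 (suc j) (j≢t ∘ FP.suc-injective))))
          (+-identityˡ _)

  alt-cong : ∀ k {x y} → x ≈ y → alt k x ≈ alt k y
  alt-cong zero   x≈y = x≈y
  alt-cong (suc k) x≈y = -‿cong (alt-cong k x≈y)

  alt-+ : ∀ k x y → alt k (x + y) ≈ alt k x + alt k y
  alt-+ zero   x y = refl
  alt-+ (suc k) x y = trans (-‿cong (alt-+ k x y)) (sym (-‿+-comm _ _))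

  alt-* : ∀ k a x → alt k (a * x) ≈ a * alt k x
  alt-* zero   a x = refl
  alt-* (suc k) a x = trans (-‿cong (alt-* k a x)) (-‿distribʳ-* a _)

  alt-0 : ∀ k → alt k 0# ≈ 0#
  alt-0 zero   = refl
  alt-0 (suc k) = trans (-‿cong (alt-0 k)) -0#≈0#

  alt-alt : ∀ m n x → alt m (alt n x) ≈ alt (m ℕ.+ n) x
  alt-alt zero   n x = refl
  alt-alt (suc m) n x = -‿cong (alt-alt m n x)

  alt≈0⇒≈0 : ∀ k {x} → alt k x ≈ 0# → x ≈ 0#
  alt≈0⇒≈0 zero   e = e
  alt≈0⇒≈0 (suc k) e = alt≈0⇒≈0 k (trans (sym (-‿involutive _)) (trans (-‿cong e) -0#≈0#))

  Σ-alt : ∀ {n} k (f : Fin n → Carrier) → Σ (λ j → alt k (f j)) ≈ alt k (Σ f)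
  Σ-alt {zero}  k f = sym (alt-0 k)
  Σ-alt {suc n} k f = trans (+-congˡ (Σ-alt k (f ∘ suc))) (sym (alt-+ k _ _))

  minor : ∀ {n} → Matrix (suc n) → Fin (suc n) → Matrix n
  minor M j i k = M (suc i) (punchIn j k)

  laplaceTerm : ∀ {n} → Matrix (suc n) → Fin (suc n) → Carrier
  laplaceTerm M j = alt (toℕ j) (M zero j * det (minor M j))

  det-cong : ∀ {n} {M N : Matrix n} → (∀ i j → M i j ≈ N i j) → det M ≈ det N
  det-cong {zero}  M≈N = refl
  det-cong {suc n} M≈N = Σ-cong λ j →
    alt-cong (toℕ j) (*-cong (M≈N zero j) (det-cong (λ i k → M≈N (suc i) (punchIn j k))))

  det-linear-column : ∀ {n} (M N P : Matrix n) t a →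
    (∀ i j → j ≢ t → P i j ≈ M i j) → (∀ i j → j ≢ t → N i j ≈ M i j) →
    (∀ i → P i t ≈ M i t + a * N i t) → det P ≈ det M + a * det N
  det-linear-column {suc n} M N P t a P≈M N≈M Pt≈ = begin
    Σ (laplaceTerm P)                                   ≈⟨ Σ-cong term-linear ⟩
    Σ (λ j → laplaceTerm M j + a * laplaceTerm N j)     ≈⟨ Σ-+ (laplaceTerm M) (λ j → a * laplaceTerm N j) ⟩
    Σ (laplaceTerm M) + Σ (λ j → a * laplaceTerm N j)   ≈⟨ +-congˡ (Σ-* a (laplaceTerm N)) ⟩
    Σ (laplaceTerm M) + a * Σ (laplaceTerm N)           ∎
    where
    split : ∀ J m n a d e → alt J (m * d + a * (n * e)) ≈ alt J (m * d) + a * alt J (n * e)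
    split J m n a d e = trans (alt-+ J _ _) (+-congˡ (alt-* J a _))

    term-linear : ∀ j → laplaceTerm P j ≈ laplaceTerm M j + a * laplaceTerm N j
    term-linear j with j F.≟ t
    ... | yes PE.refl = begin
      alt J (P zero j * det (minor P j))               ≈⟨ alt-cong J (*-cong (Pt≈ zero) (det-cong minorP≈minorM)) ⟩
      alt J ((M zero j + a * N zero j) * det (minor M j))
        ≈⟨ alt-cong J (solve 4 (λ m n a d → (m :+ a :* n) :* d := m :* d :+ a :* (n :* d)) refl _ _ _ _) ⟩
      alt J (M zero j * det (minor M j) + a * (N zero j * det (minor M j)))  ≈⟨ split J _ _ a _ _ ⟩
      laplaceTerm M j + a * alt J (N zero j * det (minor M j))
        ≈⟨ +-congˡ (*-congˡ (alt-cong J (*-congˡ (det-cong minorN≈minorM)))) ⟨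
      laplaceTerm M j + a * laplaceTerm N j            ∎
      where
      J : ℕ
      J = toℕ j
      minorP≈minorM : ∀ i k → minor P j i k ≈ minor M j i k
      minorP≈minorM i k = P≈M (suc i) (punchIn j k) (FP.punchInᵢ≢i j k)
      minorN≈minorM : ∀ i k → minor N j i k ≈ minor M j i k
      minorN≈minorM i k = N≈M (suc i) (punchIn j k) (FP.punchInᵢ≢i j k)
    ... | no j≢t = begin
      alt J (P zero j * det (minor P j))               ≈⟨ alt-cong J (*-cong (P≈M zero j j≢t) minor-linear) ⟩
      alt J (M zero j * (det (minor M j) + a * det (minor N j)))
        ≈⟨ alt-cong J (solve 4 (λ m d a e → m :* (d :+ a :* e) := m :* d :+ a :* (m :* e)) refl _ _ _ _) ⟩
      alt J (M zero j * det (minor M j) + a * (M zero j * det (minor N j)))  ≈⟨ split J _ _ a _ _ ⟩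
      laplaceTerm M j + a * alt J (M zero j * det (minor N j))
        ≈⟨ +-congˡ (*-congˡ (alt-cong J (*-congʳ (N≈M zero j j≢t)))) ⟨
      laplaceTerm M j + a * laplaceTerm N j            ∎
      where
      J : ℕ
      J = toℕ j
      t′ : Fin n
      t′ = punchOut j≢t
      punchIn-t′ : punchIn j t′ ≡ t
      punchIn-t′ = FP.punchIn-punchOut j≢t
      ≢t : ∀ k → k ≢ t′ → punchIn j k ≢ t
      ≢t k k≢t′ e = k≢t′ (FP.punchIn-injective j k t′ (PE.trans e (PE.sym punchIn-t′)))
      minor-linear : det (minor P j) ≈ det (minor M j) + a * det (minor N j)
      minor-linear = det-linear-column (minor M j) (minor N j) (minor P j) t′ a
        (λ i k k≢t′ → P≈M (suc i) (punchIn j k) (≢t k k≢t′))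
        (λ i k k≢t′ → N≈M (suc i) (punchIn j k) (≢t k k≢t′))
        (λ i → PE.subst (λ x → P (suc i) x ≈ M (suc i) x + a * N (suc i) x) (PE.sym punchIn-t′) (Pt≈ (suc i)))

  data Adjacent : ∀ {n} → Fin n → Fin n → Set where
    adjacent-zero : ∀ {n} → Adjacent {suc (suc n)} zero (suc zero)
    adjacent-suc  : ∀ {n} {u v : Fin n} → Adjacent u v → Adjacent (suc u) (suc v)

  adjacent-toℕ : ∀ {n} {u v : Fin n} → Adjacent u v → toℕ v ≡ suc (toℕ u)
  adjacent-toℕ adjacent-zero    = PE.refl
  adjacent-toℕ (adjacent-suc a) = PE.cong suc (adjacent-toℕ a)

  adjacent-≢ : ∀ {n} {u v : Fin n} → Adjacent u v → u ≢ v
  adjacent-≢ a u≡v = ℕP.1+n≢n (PE.trans (PE.sym (adjacent-toℕ a)) (PE.cong toℕ (PE.sym u≡v)))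

  adjacent-inject₁ : ∀ {n} (w : Fin n) → Adjacent (inject₁ w) (suc w)
  adjacent-inject₁ zero    = adjacent-zero
  adjacent-inject₁ (suc w) = adjacent-suc (adjacent-inject₁ w)

  adjacent-from-toℕ : ∀ {n} p → suc p < n → ∃ λ u → ∃ λ v → Adjacent {n} u v × toℕ u ≡ p × toℕ v ≡ suc p
  adjacent-from-toℕ {suc zero}    _       (ℕ.s≤s ())
  adjacent-from-toℕ {suc (suc n)} zero    _ = zero , suc zero , adjacent-zero , PE.refl , PE.refl
  adjacent-from-toℕ {suc (suc n)} (suc p) p+2<n with adjacent-from-toℕ {suc n} p (ℕP.≤-pred p+2<n)
  ... | u , v , a , u≡p , v≡p+1 = suc u , suc v , adjacent-suc a , PE.cong suc u≡p , PE.cong suc v≡p+1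

  adjacent-punchOut : ∀ {n} {u v : Fin (suc n)} → Adjacent u v →
    ∀ {j} (j≢u : j ≢ u) (j≢v : j ≢ v) → Adjacent (punchOut j≢u) (punchOut j≢v)
  adjacent-punchOut adjacent-zero {zero}                  j≢u j≢v = ⊥-elim (j≢u PE.refl)
  adjacent-punchOut adjacent-zero {suc zero}              j≢u j≢v = ⊥-elim (j≢v PE.refl)
  adjacent-punchOut adjacent-zero {suc (suc zero)}        j≢u j≢v = adjacent-zero
  adjacent-punchOut adjacent-zero {suc (suc (suc j))}     j≢u j≢v = adjacent-zero
  adjacent-punchOut (adjacent-suc a) {zero}               j≢u j≢v = a
  adjacent-punchOut (adjacent-suc adjacent-zero) {suc j}  j≢u j≢v =
    adjacent-suc (adjacent-punchOut adjacent-zero (j≢u ∘ PE.cong suc) (j≢v ∘ PE.cong suc))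
  adjacent-punchOut (adjacent-suc (adjacent-suc a)) {suc j} j≢u j≢v =
    adjacent-suc (adjacent-punchOut (adjacent-suc a) (j≢u ∘ PE.cong suc) (j≢v ∘ PE.cong suc))

  punchIn-adjacent : ∀ {n} {u v : Fin (suc n)} → Adjacent u v →
    ∀ k → punchIn u k ≡ punchIn v k ⊎ (punchIn u k ≡ v × punchIn v k ≡ u)
  punchIn-adjacent adjacent-zero    zero    = inj₂ (PE.refl , PE.refl)
  punchIn-adjacent adjacent-zero    (suc k) = inj₁ PE.refl
  punchIn-adjacent (adjacent-suc a) zero    = inj₁ PE.refl
  punchIn-adjacent (adjacent-suc a) (suc k) with punchIn-adjacent a k
  ... | inj₁ e          = inj₁ (PE.cong suc e)
  ... | inj₂ (e₁ , e₂)  = inj₂ (PE.cong suc e₁ , PE.cong suc e₂)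

  Σ-adjacent : ∀ {n} {u v : Fin n} (f : Fin n → Carrier) → Adjacent u v →
    (∀ j → j ≢ u → j ≢ v → f j ≈ 0#) → f u + f v ≈ 0# → Σ f ≈ 0#
  Σ-adjacent f adjacent-zero f≈0 fu+fv≈0 = begin
    f zero + (f (suc zero) + Σ (λ j → f (suc (suc j))))  ≈⟨ +-congˡ (+-congˡ (Σ-0 _ (λ j → f≈0 (suc (suc j)) (λ ()) (λ ())))) ⟩
    f zero + (f (suc zero) + 0#)                         ≈⟨ +-congˡ (+-identityʳ _) ⟩
    f zero + f (suc zero)                                ≈⟨ fu+fv≈0 ⟩
    0#                                                   ∎
  Σ-adjacent f (adjacent-suc a) f≈0 fu+fv≈0 =
    trans (+-cong (f≈0 zero (λ ()) (λ ()))
                  (Σ-adjacent (f ∘ suc) a (λ j j≢u j≢v → f≈0 (suc j) (j≢u ∘ FP.suc-injective) (j≢v ∘ FP.suc-injective)) fu+fv≈0))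
          (+-identityʳ 0#)

  -- Columns u and v cancel in the expansion: their minors agree and their signs differ.
  det-equal-adjacent : ∀ {n} (M : Matrix n) {u v : Fin n} → Adjacent u v → (∀ i → M i u ≈ M i v) → det M ≈ 0#
  det-equal-adjacent {suc n} M {u} {v} a Mu≈Mv = Σ-adjacent (laplaceTerm M) a other-terms≈0 (begin
    laplaceTerm M u + alt (toℕ v) (M zero v * det (minor M v))
      ≡⟨ PE.cong (λ k → laplaceTerm M u + alt k (M zero v * det (minor M v))) (adjacent-toℕ a) ⟩
    laplaceTerm M u + - alt (toℕ u) (M zero v * det (minor M v))
      ≈⟨ +-congˡ (-‿cong (alt-cong (toℕ u) (*-cong (Mu≈Mv zero) (det-cong minors-agree)))) ⟨
    laplaceTerm M u + - laplaceTerm M u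
      ≈⟨ -‿inverseʳ _ ⟩
    0#
      ∎)
    where
    other-terms≈0 : ∀ j → j ≢ u → j ≢ v → laplaceTerm M j ≈ 0#
    other-terms≈0 j j≢u j≢v = trans (alt-cong (toℕ j) (trans (*-congˡ minor≈0) (zeroʳ _))) (alt-0 (toℕ j))
      where
      minor≈0 : det (minor M j) ≈ 0#
      minor≈0 = det-equal-adjacent (minor M j) (adjacent-punchOut a j≢u j≢v) λ i →
        PE.subst₂ (λ x y → M (suc i) x ≈ M (suc i) y)
          (PE.sym (FP.punchIn-punchOut j≢u)) (PE.sym (FP.punchIn-punchOut j≢v)) (Mu≈Mv (suc i))
    minors-agree : ∀ i k → minor M u i k ≈ minor M v i k
    minors-agree i k with punchIn-adjacent a k
    ... | inj₁ e         = reflexive (PE.cong (M (suc i)) e)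
    ... | inj₂ (e₁ , e₂) = trans (reflexive (PE.cong (M (suc i)) e₁))
                             (trans (sym (Mu≈Mv (suc i))) (reflexive (PE.cong (M (suc i)) (PE.sym e₂))))

  setColumn : ∀ {n} → Matrix n → Fin n → (Fin n → Carrier) → Matrix n
  setColumn M u f i j with j F.≟ u
  ... | yes _ = f i
  ... | no  _ = M i j

  setColumn-≡ : ∀ {n} (M : Matrix n) u f i → setColumn M u f i u ≈ f i
  setColumn-≡ M u f i with u F.≟ u
  ... | yes _   = refl
  ... | no u≢u  = ⊥-elim (u≢u PE.refl)

  setColumn-≢ : ∀ {n} (M : Matrix n) u f i j → j ≢ u → setColumn M u f i j ≈ M i j
  setColumn-≢ M u f i j j≢u with j F.≟ u
  ... | yes j≡u = ⊥-elim (j≢u j≡u)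
  ... | no _    = refl

  -- With X f g the matrix whose columns u, v are f, g: expanding det (X (f + g) (f + g)) = 0
  -- by bilinearity leaves det (X f g) + det (X g f) = 0.
  det-swap-adjacent : ∀ {n} (M M′ : Matrix n) {u v} → Adjacent u v →
    (∀ i j → j ≢ u → j ≢ v → M′ i j ≈ M i j) → (∀ i → M′ i u ≈ M i v) → (∀ i → M′ i v ≈ M i u) →
    det M′ ≈ - det M
  det-swap-adjacent {n} M M′ {u} {v} a M′≈M M′u≈Mv M′v≈Mu = inverseʳ-unique (det M) (det M′) (begin
    det M + det M′
      ≈⟨ +-cong (det-X cu cv M (λ _ → refl) (λ _ → refl) (λ _ _ _ _ → refl))
                (det-X cv cu M′ M′u≈Mv M′v≈Mu M′≈M) ⟨
    det (X cu cv) + det (X cv cu)                                      ≈⟨ +-cong (+-identityˡ _) (+-identityʳ _) ⟨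
    (0# + det (X cu cv)) + (det (X cv cu) + 0#)                        ≈⟨ +-cong (+-congʳ (X-diagonal cu)) (+-congˡ (X-diagonal cv)) ⟨
    (det (X cu cu) + det (X cu cv)) + (det (X cv cu) + det (X cv cv))  ≈⟨ +-cong (additiveᵛ cu) (additiveᵛ cv) ⟨
    det (X cu s) + det (X cv s)                                        ≈⟨ additiveᵘ s ⟨
    det (X s s)                                                        ≈⟨ X-diagonal s ⟩
    0#                                                                 ∎)
    where
    u≢v : u ≢ v
    u≢v = adjacent-≢ a

    X : (Fin n → Carrier) → (Fin n → Carrier) → Matrix n
    X f g = setColumn (setColumn M u f) v g

    X-u : ∀ f g i → X f g i u ≈ f i
    X-u f g i = trans (setColumn-≢ _ v g i u u≢v) (setColumn-≡ M u f i)

    X-v : ∀ f g i → X f g i v ≈ g i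
    X-v f g i = setColumn-≡ _ v g i

    X-other : ∀ f g i j → j ≢ u → j ≢ v → X f g i j ≈ M i j
    X-other f g i j j≢u j≢v = trans (setColumn-≢ _ v g i j j≢v) (setColumn-≢ M u f i j j≢u)

    X-off-u : ∀ f f′ g i j → j ≢ u → X f g i j ≈ X f′ g i j
    X-off-u f f′ g i j j≢u = cases (j F.≟ v)
      where
      cases : Dec (j ≡ v) → X f g i j ≈ X f′ g i j
      cases (yes j≡v) = PE.subst (λ x → X f g i x ≈ X f′ g i x) (PE.sym j≡v) (trans (X-v f g i) (sym (X-v f′ g i)))
      cases (no j≢v)  = trans (X-other f g i j j≢u j≢v) (sym (X-other f′ g i j j≢u j≢v))

    X-off-v : ∀ f g g′ i j → j ≢ v → X f g i j ≈ X f g′ i j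
    X-off-v f g g′ i j j≢v = cases (j F.≟ u)
      where
      cases : Dec (j ≡ u) → X f g i j ≈ X f g′ i j
      cases (yes j≡u) = PE.subst (λ x → X f g i x ≈ X f g′ i x) (PE.sym j≡u) (trans (X-u f g i) (sym (X-u f g′ i)))
      cases (no j≢u)  = trans (X-other f g i j j≢u j≢v) (sym (X-other f g′ i j j≢u j≢v))

    det-X : ∀ f g (N : Matrix n) → (∀ i → N i u ≈ f i) → (∀ i → N i v ≈ g i) →
      (∀ i j → j ≢ u → j ≢ v → N i j ≈ M i j) → det (X f g) ≈ det N
    det-X f g N Nu≈f Nv≈g N≈M = det-cong X≈N
      where
      X≈N : ∀ i j → X f g i j ≈ N i j
      X≈N i j = cases (j F.≟ u) (j F.≟ v)
        where
        at : ∀ {w} → j ≡ w → X f g i w ≈ N i w → X f g i j ≈ N i j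
        at j≡w = PE.subst (λ x → X f g i x ≈ N i x) (PE.sym j≡w)
        cases : Dec (j ≡ u) → Dec (j ≡ v) → X f g i j ≈ N i j
        cases (yes j≡u) _         = at j≡u (trans (X-u f g i) (sym (Nu≈f i)))
        cases (no _)    (yes j≡v) = at j≡v (trans (X-v f g i) (sym (Nv≈g i)))
        cases (no j≢u)  (no j≢v)  = trans (X-other f g i j j≢u j≢v) (sym (N≈M i j j≢u j≢v))

    X-diagonal : ∀ f → det (X f f) ≈ 0#
    X-diagonal f = det-equal-adjacent (X f f) a (λ i → trans (X-u f f i) (sym (X-v f f i)))

    cu cv s : Fin n → Carrier
    cu i = M i u
    cv i = M i v
    s i = cu i + cv i

    sum-entry : ∀ {z x y a b} → z ≈ a + b → x ≈ a → y ≈ b → z ≈ x + 1# * y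
    sum-entry z≈a+b x≈a y≈b = trans z≈a+b (+-cong (sym x≈a) (trans (sym (*-identityˡ _)) (*-congˡ (sym y≈b))))

    additiveᵘ : ∀ g → det (X s g) ≈ det (X cu g) + det (X cv g)
    additiveᵘ g = trans
      (det-linear-column (X cu g) (X cv g) (X s g) u 1# (X-off-u s cu g) (X-off-u cv cu g)
        (λ i → sum-entry (X-u s g i) (X-u cu g i) (X-u cv g i)))
      (+-congˡ (*-identityˡ _))

    additiveᵛ : ∀ f → det (X f s) ≈ det (X f cu) + det (X f cv)
    additiveᵛ f = trans
      (det-linear-column (X f cu) (X f cv) (X f s) v 1# (X-off-v f s cu) (X-off-v f cv cu)
        (λ i → sum-entry (X-v f s i) (X-v f cu i) (X-v f cv i)))
      (+-congˡ (*-identityˡ _))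

  det-equal-columns : ∀ {n} (M : Matrix (suc n)) (w : Fin n) → (∀ i → M i zero ≈ M i (suc w)) → det M ≈ 0#
  det-equal-columns M w = go (toℕ w) M w PE.refl
    where
    -- Swap the equal column one step to the left; k = toℕ w makes the recursion on inject₁ w structural.
    go : ∀ {n} k (M : Matrix (suc n)) (w : Fin n) → toℕ w ≡ k → (∀ i → M i zero ≈ M i (suc w)) → det M ≈ 0#
    go k       M zero    _    M0≈Mw = det-equal-adjacent M adjacent-zero M0≈Mw
    go (suc k) M (suc w) w≡k+1 M0≈Mw = begin
      det M        ≈⟨ -‿involutive _ ⟨
      - - det M    ≈⟨ -‿cong swapped ⟨
      - det M′     ≈⟨ -‿cong (go k M′ (inject₁ w) (PE.trans (FP.toℕ-inject₁ w) (ℕP.suc-injective w≡k+1)) M′0≈M′v) ⟩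
      - 0#         ≈⟨ -0#≈0# ⟩
      0#           ∎
      where
      v W : Fin _
      v = suc (inject₁ w)
      W = suc (suc w)
      a : Adjacent v W
      a = adjacent-inject₁ (suc w)
      M″ M′ : Matrix _
      M″ = setColumn M v (λ i → M i W)
      M′ = setColumn M″ W (λ i → M i v)
      M′-v : ∀ i → M′ i v ≈ M i W
      M′-v i = trans (setColumn-≢ M″ W _ i v (adjacent-≢ a)) (setColumn-≡ M v _ i)
      M′-0 : ∀ i → M′ i zero ≈ M i zero
      M′-0 i = trans (setColumn-≢ M″ W (λ i → M i v) i zero (λ ())) (setColumn-≢ M v (λ i → M i W) i zero (λ ()))
      swapped : det M′ ≈ - det M
      swapped = det-swap-adjacent M M′ a
        (λ i j j≢v j≢W → trans (setColumn-≢ M″ W _ i j j≢W) (setColumn-≢ M v _ i j j≢v))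
        M′-v (λ i → setColumn-≡ M″ W _ i)
      M′0≈M′v : ∀ i → M′ i zero ≈ M′ i v
      M′0≈M′v i = trans (M′-0 i) (trans (M0≈Mw i) (sym (M′-v i)))

  det-add-multiple : ∀ {n} (M P : Matrix n) w a (f : Fin n → Carrier) → det (setColumn M w f) ≈ 0# →
    (∀ i j → j ≢ w → P i j ≈ M i j) → (∀ i → P i w ≈ M i w + a * f i) → det P ≈ det M
  det-add-multiple M P w a f det≈0 P≈M Pw≈ = begin
    det P                                 ≈⟨ det-linear-column M (setColumn M w f) P w a P≈M (setColumn-≢ M w f)
                                               (λ i → trans (Pw≈ i) (+-congˡ (*-congˡ (sym (setColumn-≡ M w f i))))) ⟩
    det M + a * det (setColumn M w f)     ≈⟨ +-congˡ (trans (*-congˡ det≈0) (zeroʳ a)) ⟩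
    det M + 0#                            ≈⟨ +-identityʳ _ ⟩
    det M                                 ∎

  det-subtract-adjacent : ∀ {n} (M P : Matrix n) {u v} → Adjacent u v →
    (∀ i j → j ≢ u → P i j ≈ M i j) → (∀ i → P i u ≈ M i u - M i v) → det P ≈ det M
  det-subtract-adjacent M P {u} {v} a P≈M Pu≈ = det-add-multiple M P u (- 1#) (λ i → M i v)
    (det-equal-adjacent (setColumn M u (λ i → M i v)) a λ i →
      trans (setColumn-≡ M u _ i) (sym (setColumn-≢ M u _ i v (adjacent-≢ a ∘ PE.sym))))
    P≈M (λ i → trans (Pu≈ i) (+-congˡ (sym (-1*x≈-x _))))

  choose : ∀ {p} {P : Set p} → Dec P → Carrier → Carrier → Carrier
  choose (yes _) x y = x
  choose (no _)  x y = y

  choose-yes : ∀ {p} {P : Set p} (d : Dec P) x y → P → choose d x y ≈ x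
  choose-yes (yes _)  x y _ = refl
  choose-yes (no ¬p)  x y p = ⊥-elim (¬p p)

  choose-no : ∀ {p} {P : Set p} (d : Dec P) x y → ¬ P → choose d x y ≈ y
  choose-no (yes p) x y ¬p = ⊥-elim (¬p p)
  choose-no (no _)  x y _  = refl

  subtractColumn₀ : ∀ {n} → Matrix (suc n) → (Fin n → Carrier) → Matrix (suc n)
  subtractColumn₀ M μ i zero    = M i zero
  subtractColumn₀ M μ i (suc t) = M i (suc t) - μ t * M i zero

  subtractColumn₀-cong : ∀ {n} (M : Matrix (suc n)) {μ ν : Fin n → Carrier} → (∀ t → μ t ≈ ν t) →
    ∀ i j → subtractColumn₀ M μ i j ≈ subtractColumn₀ M ν i j
  subtractColumn₀-cong M μ≈ν i zero    = refl
  subtractColumn₀-cong M μ≈ν i (suc t) = +-congˡ (-‿cong (*-congʳ (μ≈ν t)))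

  det-subtract-column₀-once : ∀ {n} (M P : Matrix (suc n)) t μ →
    (∀ i j → j ≢ suc t → P i j ≈ M i j) → (∀ i → P i (suc t) ≈ M i (suc t) - μ * M i zero) → det P ≈ det M
  det-subtract-column₀-once M P t μ P≈M Pt≈ = det-add-multiple M P (suc t) (- μ) column₀
    (det-equal-columns (setColumn M (suc t) column₀) t λ i →
      trans (setColumn-≢ M (suc t) column₀ i zero (λ ())) (sym (setColumn-≡ M (suc t) column₀ i)))
    P≈M (λ i → trans (Pt≈ i) (+-congˡ (-‿distribˡ-* μ _)))
    where
    column₀ : Fin _ → Carrier
    column₀ i = M i zero

  det-subtractColumn₀ : ∀ {n} (M : Matrix (suc n)) μ → det (subtractColumn₀ M μ) ≈ det M
  det-subtractColumn₀ {n} M μ =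
    trans (det-cong (subtractColumn₀-cong M (λ t → sym (restrict-< n t (FP.toℕ<n t))))) (first n ℕP.≤-refl)
    where
    restrict : ℕ → Fin n → Carrier
    restrict k t = choose (toℕ t ℕ.<? k) (μ t) 0#
    restrict-< : ∀ k t → toℕ t < k → restrict k t ≈ μ t
    restrict-< k t = choose-yes (toℕ t ℕ.<? k) _ _
    restrict-≮ : ∀ k t → ¬ (toℕ t < k) → restrict k t ≈ 0#
    restrict-≮ k t = choose-no (toℕ t ℕ.<? k) _ _
    restrict-suc : ∀ k t → toℕ t ≢ k → restrict (suc k) t ≈ restrict k t
    restrict-suc k t t≢k with toℕ t ℕ.<? k
    ... | yes t<k = restrict-< (suc k) t (ℕP.m<n⇒m<1+n t<k)
    ... | no  t≮k = restrict-≮ (suc k) t (λ t<k+1 → t≮k (ℕP.≤∧≢⇒< (ℕP.≤-pred t<k+1) t≢k))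

    step : ∀ k → k < n → det (subtractColumn₀ M (restrict (suc k))) ≈ det (subtractColumn₀ M (restrict k))
    step k k<n = det-subtract-column₀-once _ _ t (μ t) others at-t
      where
      t : Fin n
      t = fromℕ< k<n
      t≡k : toℕ t ≡ k
      t≡k = FP.toℕ-fromℕ< k<n
      others : ∀ i j → j ≢ suc t → subtractColumn₀ M (restrict (suc k)) i j ≈ subtractColumn₀ M (restrict k) i j
      others i zero    _     = refl
      others i (suc t′) t′≢t = subtractColumn₀-cong M (λ _ → restrict-suc k t′ t′≢k) i (suc t′)
        where
        t′≢k : toℕ t′ ≢ k
        t′≢k e = t′≢t (PE.cong suc (FP.toℕ-injective (PE.trans e (PE.sym t≡k))))
      at-t : ∀ i → M i (suc t) - restrict (suc k) t * M i zero ≈ (M i (suc t) - restrict k t * M i zero) - μ t * M i zero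
      at-t i = begin
        M i (suc t) - restrict (suc k) t * M i zero       ≈⟨ +-congˡ (-‿cong (*-congʳ (restrict-< (suc k) t (ℕP.≤-reflexive (PE.cong suc t≡k))))) ⟩
        M i (suc t) - μ t * M i zero                      ≈⟨ +-congʳ (solve 2 (λ x y → x :- con (+ 0) :* y := x) refl _ _) ⟨
        (M i (suc t) - 0# * M i zero) - μ t * M i zero    ≈⟨ +-congʳ (+-congˡ (-‿cong (*-congʳ (restrict-≮ k t (ℕP.<-irrefl t≡k))))) ⟨
        (M i (suc t) - restrict k t * M i zero) - μ t * M i zero ∎

    first : ∀ k → k ≤ℕ n → det (subtractColumn₀ M (restrict k)) ≈ det M
    first zero   _     = det-cong {M = subtractColumn₀ M (restrict 0)} {N = M} λ where
      i zero    → refl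
      i (suc t) → trans (+-congˡ (trans (-‿cong (trans (*-congʳ (restrict-≮ 0 t (λ ()))) (zeroˡ _))) -0#≈0#)) (+-identityʳ _)
    first (suc k) k<n = trans (step k k<n) (first k (ℕP.<⇒≤ k<n))

  det-row₀-head : ∀ {n} (M : Matrix (suc n)) → (∀ j → M zero (suc j) ≈ 0#) →
    det M ≈ M zero zero * det (λ i k → M (suc i) (suc k))
  det-row₀-head M row₀≈0 = trans (+-congˡ (Σ-0 _ tail≈0)) (+-identityʳ _)
    where
    tail≈0 : ∀ j → laplaceTerm M (suc j) ≈ 0#
    tail≈0 j = trans (alt-cong (suc (toℕ j)) (trans (*-congʳ (row₀≈0 j)) (zeroˡ _))) (alt-0 (suc (toℕ j)))

  det-column₀-last : ∀ n (M : Matrix (suc n)) → (∀ i → M (inject₁ i) zero ≈ 0#) →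
    det M ≈ alt n (M (fromℕ n) zero * det (λ i k → M (inject₁ i) (suc k)))
  det-column₀-last zero   M _          = +-identityʳ _
  det-column₀-last (suc n) M column₀≈0 = begin
    laplaceTerm M zero + Σ (λ j → laplaceTerm M (suc j))  ≈⟨ +-cong head≈0 (Σ-cong tail≈) ⟩
    0# + Σ (λ j → alt (suc n) (D * laplaceTerm T j))      ≈⟨ +-identityˡ _ ⟩
    Σ (λ j → alt (suc n) (D * laplaceTerm T j))           ≈⟨ Σ-alt (suc n) (λ j → D * laplaceTerm T j) ⟩
    alt (suc n) (Σ (λ j → D * laplaceTerm T j))           ≈⟨ alt-cong (suc n) (Σ-* D (laplaceTerm T)) ⟩
    alt (suc n) (D * det T)                               ∎
    where
    D : Carrier
    D = M (fromℕ (suc n)) zero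
    T : Matrix (suc n)
    T i k = M (inject₁ i) (suc k)
    head≈0 : laplaceTerm M zero ≈ 0#
    head≈0 = trans (*-congʳ (column₀≈0 zero)) (zeroˡ _)
    commute-signs : ∀ J a x → alt (suc J) (a * alt n (D * x)) ≈ alt (suc n) (D * alt J (a * x))
    commute-signs J a x = begin
      alt (suc J) (a * alt n (D * x))       ≈⟨ alt-cong (suc J) (alt-* n a _) ⟨
      alt (suc J) (alt n (a * (D * x)))     ≈⟨ alt-alt (suc J) n _ ⟩
      alt (suc (J ℕ.+ n)) (a * (D * x))     ≡⟨ PE.cong (λ k → alt (suc k) (a * (D * x))) (ℕP.+-comm J n) ⟩
      alt (suc (n ℕ.+ J)) (a * (D * x))     ≈⟨ alt-cong (suc (n ℕ.+ J)) (solve 3 (λ a D x → a :* (D :* x) := D :* (a :* x)) refl a D x) ⟩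
      alt (suc (n ℕ.+ J)) (D * (a * x))     ≈⟨ alt-alt (suc n) J _ ⟨
      alt (suc n) (alt J (D * (a * x)))     ≈⟨ alt-cong (suc n) (alt-* J D _) ⟩
      alt (suc n) (D * alt J (a * x))       ∎
    tail≈ : ∀ j → laplaceTerm M (suc j) ≈ alt (suc n) (D * laplaceTerm T j)
    tail≈ j = trans (alt-cong (suc (toℕ j)) (*-congˡ (det-column₀-last n (minor M (suc j)) (column₀≈0 ∘ suc))))
                    (commute-signs (toℕ j) _ _)

  Π : ∀ {n} → (Fin n → Carrier) → Carrier
  Π {zero}  s = 1#
  Π {suc n} s = s zero * Π (s ∘ suc)

  Π-≉0 : ∀ {n} (s : Fin n → Carrier) → (∀ i → ¬ (s i ≈ 0#)) → ¬ (Π s ≈ 0#)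
  Π-≉0 {zero}  s s≉0 = 1≉0
  Π-≉0 {suc n} s s≉0 = *-≉0 (s≉0 zero) (Π-≉0 (s ∘ suc) (s≉0 ∘ suc))

  det-scale-rows : ∀ {n} (s : Fin n → Carrier) (M : Matrix n) → det (λ i j → s i * M i j) ≈ Π s * det M
  det-scale-rows {zero}  s M = sym (*-identityˡ 1#)
  det-scale-rows {suc n} s M = trans (Σ-cong term≈) (Σ-* _ (laplaceTerm M))
    where
    term≈ : ∀ j → laplaceTerm (λ i j → s i * M i j) j ≈ Π s * laplaceTerm M j
    term≈ j = trans (alt-cong (toℕ j) (trans (*-congˡ (det-scale-rows (s ∘ suc) (minor M j)))
      (solve 4 (λ a b p d → (a :* b) :* (p :* d) := (a :* p) :* (b :* d)) refl _ _ _ _))) (alt-* (toℕ j) _ _)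

  Cong : (Carrier → Carrier) → Set (c ⊔ r)
  Cong φ = ∀ {x y} → x ≈ y → φ x ≈ φ y

  -- IsPoly d l φ: φ is a polynomial function of formal degree d with coefficient l at x ^ d,
  -- witnessed in Horner form φ x = c₀ + x * ψ x.
  IsPoly : ℕ → Carrier → (Carrier → Carrier) → Set (c ⊔ r)
  IsPoly zero   l φ = ∀ x → φ x ≈ l
  IsPoly (suc d) l φ = ∃ λ ψ → ∃ λ c₀ → IsPoly d l ψ × (∀ x → φ x ≈ c₀ + x * ψ x)

  isPoly-cong : ∀ d {l φ} → IsPoly d l φ → Cong φ
  isPoly-cong zero   φ≈l {x} {y} x≈y = trans (φ≈l x) (sym (φ≈l y))
  isPoly-cong (suc d) (ψ , c₀ , ψ-poly , φ≈) {x} {y} x≈y =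
    trans (φ≈ x) (trans (+-congˡ (*-cong x≈y (isPoly-cong d ψ-poly x≈y))) (sym (φ≈ y)))

  isPoly-resp : ∀ d {l l′ φ χ} → IsPoly d l φ → (∀ x → φ x ≈ χ x) → l ≈ l′ → IsPoly d l′ χ
  isPoly-resp zero   φ≈l φ≈χ l≈l′ x = trans (sym (φ≈χ x)) (trans (φ≈l x) l≈l′)
  isPoly-resp (suc d) (ψ , c₀ , ψ-poly , φ≈) φ≈χ l≈l′ =
    ψ , c₀ , isPoly-resp d ψ-poly (λ _ → refl) l≈l′ , (λ x → trans (sym (φ≈χ x)) (φ≈ x))

  isPoly-lift : ∀ d {l φ} → IsPoly d l φ → IsPoly (suc d) 0# φ
  isPoly-lift zero   {l} φ≈l = (λ _ → 0#) , l , (λ _ → refl) , (λ x → trans (φ≈l x) (sym (trans (+-congˡ (zeroʳ x)) (+-identityʳ l))))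
  isPoly-lift (suc d) (ψ , c₀ , ψ-poly , φ≈) = ψ , c₀ , isPoly-lift d ψ-poly , φ≈

  isPoly-raise : ∀ {d e l φ} → d < e → IsPoly d l φ → IsPoly e 0# φ
  isPoly-raise {d} {suc e} d<e+1 φ-poly with ℕP.m≤n⇒m<n∨m≡n (ℕP.≤-pred d<e+1)
  ... | inj₁ d<e     = isPoly-lift e (isPoly-raise d<e φ-poly)
  ... | inj₂ PE.refl = isPoly-lift d φ-poly

  isPoly-0 : ∀ d → IsPoly d 0# (λ _ → 0#)
  isPoly-0 zero   _ = refl
  isPoly-0 (suc d) = isPoly-lift d (isPoly-0 d)

  isPoly-+ : ∀ d {l m φ χ} → IsPoly d l φ → IsPoly d m χ → IsPoly d (l + m) (λ x → φ x + χ x)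
  isPoly-+ zero   φ≈l χ≈m x = +-cong (φ≈l x) (χ≈m x)
  isPoly-+ (suc d) (ψ , c₀ , ψ-poly , φ≈) (ψ′ , c₀′ , ψ′-poly , χ≈) =
    (λ x → ψ x + ψ′ x) , c₀ + c₀′ , isPoly-+ d ψ-poly ψ′-poly ,
    (λ x → trans (+-cong (φ≈ x) (χ≈ x))
      (solve 5 (λ a b x u v → (a :+ x :* u) :+ (b :+ x :* v) := (a :+ b) :+ x :* (u :+ v)) refl _ _ _ _ _))

  isPoly-scale : ∀ d a {l φ} → IsPoly d l φ → IsPoly d (a * l) (λ x → a * φ x)
  isPoly-scale zero   a φ≈l x = *-congˡ (φ≈l x)
  isPoly-scale (suc d) a (ψ , c₀ , ψ-poly , φ≈) =
    (λ x → a * ψ x) , a * c₀ , isPoly-scale d a ψ-poly ,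
    (λ x → trans (*-congˡ (φ≈ x)) (solve 4 (λ a c x u → a :* (c :+ x :* u) := a :* c :+ x :* (a :* u)) refl _ _ _ _))

  isPoly-mulX : ∀ d {l φ} → IsPoly d l φ → IsPoly (suc d) l (λ x → x * φ x)
  isPoly-mulX d {φ = φ} φ-poly = φ , 0# , φ-poly , (λ x → sym (+-identityˡ _))

  isPoly-mulXs : ∀ s d {l φ} → IsPoly d l φ → IsPoly (s ℕ.+ d) l (λ x → x ^ s * φ x)
  isPoly-mulXs zero   d φ-poly = isPoly-resp d φ-poly (λ _ → sym (*-identityˡ _)) refl
  isPoly-mulXs (suc s) d φ-poly =
    isPoly-resp (suc (s ℕ.+ d)) (isPoly-mulX (s ℕ.+ d) (isPoly-mulXs s d φ-poly)) (λ _ → sym (*-assoc _ _ _)) refl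

  isPoly-mulLinear : ∀ d b h {l φ} → IsPoly d l φ → IsPoly (suc d) (h * l) (λ x → (b + x * h) * φ x)
  isPoly-mulLinear d b h φ-poly =
    isPoly-resp (suc d) (isPoly-+ (suc d) (isPoly-lift d (isPoly-scale d b φ-poly)) (isPoly-scale (suc d) h (isPoly-mulX d φ-poly)))
      (λ x → solve 4 (λ b x h u → b :* u :+ h :* (x :* u) := (b :+ x :* h) :* u) refl _ _ _ _)
      (+-identityˡ _)

  isPoly-pow : ∀ k → IsPoly k 1# (_^ k)
  isPoly-pow zero   _ = refl
  isPoly-pow (suc k) = isPoly-mulX k (isPoly-pow k)

  isPoly-powLinear : ∀ ξ h k → IsPoly k (h ^ k) (λ y → (ξ + y * h) ^ k)
  isPoly-powLinear ξ h zero   _ = refl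
  isPoly-powLinear ξ h (suc k) = isPoly-mulLinear k ξ h (isPoly-powLinear ξ h k)

  isPoly-shift : ∀ d b {l φ} → IsPoly d l φ → IsPoly d l (λ x → φ (b + x))
  isPoly-shift zero   b φ≈l x = φ≈l (b + x)
  isPoly-shift (suc d) b {l} (ψ , c₀ , ψ-poly , φ≈) =
    isPoly-resp (suc d) (isPoly-+ (suc d) (isPoly-raise (ℕ.s≤s ℕ.z≤n) (λ _ → refl)) (isPoly-mulLinear d b 1# (isPoly-shift d b ψ-poly)))
      (λ x → trans (+-congˡ (*-congʳ (+-congˡ (*-identityʳ x)))) (sym (φ≈ (b + x))))
      (trans (+-identityˡ _) (*-identityˡ l))

  isPoly-Σ : ∀ {n} d (l : Fin n → Carrier) (φ : Fin n → Carrier → Carrier) → (∀ k → IsPoly d (l k) (φ k)) →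
    IsPoly d (Σ l) (λ y → Σ (λ k → φ k y))
  isPoly-Σ {zero}  d l φ φ-poly = isPoly-0 d
  isPoly-Σ {suc n} d l φ φ-poly = isPoly-+ d (φ-poly zero) (isPoly-Σ d (l ∘ suc) (φ ∘ suc) (φ-poly ∘ suc))

  isPoly-eval-affine : ∀ {n} (q : Fin (suc n) → Carrier) ξ h d (t : Fin (suc n)) → toℕ t ≡ d →
    (∀ k → d < toℕ k → q k ≈ 0#) → IsPoly d (q t * h ^ d) (λ y → eval q (ξ + y * h))
  isPoly-eval-affine q ξ h d t t≡d q≈0 =
    isPoly-resp d (isPoly-Σ d lead (λ k y → q k * (ξ + y * h) ^ toℕ k) term-poly) (λ _ → refl)
      (trans (Σ-single lead t lead-≢t) (choose-yes (toℕ t ℕ.≟ d) _ _ t≡d))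
    where
    lead : Fin _ → Carrier
    lead k = choose (toℕ k ℕ.≟ d) (q k * h ^ d) 0#
    lead-≢t : ∀ k → k ≢ t → lead k ≈ 0#
    lead-≢t k k≢t = choose-no (toℕ k ℕ.≟ d) _ _ (λ k≡d → k≢t (FP.toℕ-injective (PE.trans k≡d (PE.sym t≡d))))
    term-poly : ∀ k → IsPoly d (lead k) (λ y → q k * (ξ + y * h) ^ toℕ k)
    term-poly k with ℕP.<-cmp (toℕ k) d
    ... | tri< k<d k≢d _ = isPoly-resp d (isPoly-scale d (q k) (isPoly-raise k<d (isPoly-powLinear ξ h (toℕ k))))
                             (λ _ → refl) (trans (zeroʳ _) (sym (choose-no (toℕ k ℕ.≟ d) _ _ k≢d)))
    ... | tri≈ _ k≡d _   = isPoly-resp d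
                             (isPoly-scale d (q k) (PE.subst (λ e → IsPoly e (h ^ e) (λ y → (ξ + y * h) ^ toℕ k)) k≡d
                               (isPoly-powLinear ξ h (toℕ k))))
                             (λ _ → refl) (sym (choose-yes (toℕ k ℕ.≟ d) _ _ k≡d))
    ... | tri> _ k≢d d<k = isPoly-resp d (isPoly-0 d) (λ _ → sym (trans (*-congʳ (q≈0 k d<k)) (zeroˡ _)))
                             (sym (choose-no (toℕ k ℕ.≟ d) _ _ k≢d))

  horner-difference : ∀ c y u a v → (c + y * u) - (c + a * v) ≈ (y - a) * u + a * (u - v)
  horner-difference = solve 5 (λ c y u a v → (c :+ y :* u) :- (c :+ a :* v) := (y :- a) :* u :+ a :* (u :- v)) refl

  isPoly-factor : ∀ d {l φ} → IsPoly (suc d) l φ → ∀ a → ∃ λ χ → IsPoly d l χ × (∀ y → φ y - φ a ≈ (y - a) * χ y)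
  isPoly-factor zero {l} {φ} (ψ , c₀ , ψ≈l , φ≈) a = (λ _ → l) , (λ _ → refl) , λ y → begin
    φ y - φ a                         ≈⟨ +-cong (φ≈ y) (-‿cong (φ≈ a)) ⟩
    (c₀ + y * ψ y) - (c₀ + a * ψ a)   ≈⟨ horner-difference c₀ y (ψ y) a (ψ a) ⟩
    (y - a) * ψ y + a * (ψ y - ψ a)   ≈⟨ +-cong (*-congˡ (ψ≈l y)) (*-congˡ (trans (+-cong (ψ≈l y) (-‿cong (ψ≈l a))) (-‿inverseʳ l))) ⟩
    (y - a) * l + a * 0#              ≈⟨ trans (+-congˡ (zeroʳ a)) (+-identityʳ _) ⟩
    (y - a) * l                       ∎
  isPoly-factor (suc d) {l} {φ} (ψ , c₀ , ψ-poly , φ≈) a with isPoly-factor d ψ-poly a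
  ... | χ , χ-poly , ψ-factor =
    (λ y → ψ y + a * χ y) ,
    isPoly-resp (suc d) (isPoly-+ (suc d) ψ-poly (isPoly-lift d (isPoly-scale d a χ-poly))) (λ _ → refl) (+-identityʳ l) ,
    λ y → begin
      φ y - φ a                             ≈⟨ +-cong (φ≈ y) (-‿cong (φ≈ a)) ⟩
      (c₀ + y * ψ y) - (c₀ + a * ψ a)       ≈⟨ horner-difference c₀ y (ψ y) a (ψ a) ⟩
      (y - a) * ψ y + a * (ψ y - ψ a)       ≈⟨ +-congˡ (*-congˡ (ψ-factor y)) ⟩
      (y - a) * ψ y + a * ((y - a) * χ y)
        ≈⟨ solve 4 (λ y a u w → (y :- a) :* u :+ a :* ((y :- a) :* w) := (y :- a) :* (u :+ a :* w)) refl y a (ψ y) (χ y) ⟩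
      (y - a) * (ψ y + a * χ y)             ∎

  Δ : (Carrier → Carrier) → Carrier → Carrier
  Δ φ x = φ x - φ (1# + x)

  Δⁿ : ℕ → (Carrier → Carrier) → Carrier → Carrier
  Δⁿ zero   φ = φ
  Δⁿ (suc k) φ = Δ (Δⁿ k φ)

  Δⁿ-cong : ∀ k {φ} → Cong φ → Cong (Δⁿ k φ)
  Δⁿ-cong zero   φ-cong = φ-cong
  Δⁿ-cong (suc k) φ-cong x≈y = +-cong (Δⁿ-cong k φ-cong x≈y) (-‿cong (Δⁿ-cong k φ-cong (+-congˡ x≈y)))

  Δ-horner : ∀ {φ ψ c₀} → (∀ x → φ x ≈ c₀ + x * ψ x) → ∀ x → Δ φ x ≈ x * Δ ψ x + (- 1#) * ψ (1# + x)
  Δ-horner {φ} {ψ} {c₀} φ≈ x = trans (+-cong (φ≈ x) (-‿cong (φ≈ (1# + x))))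
    (solve 5 (λ c x a b o → (c :+ x :* a) :- (c :+ (o :+ x) :* b) := x :* (a :- b) :+ (:- o) :* b) refl c₀ x (ψ x) (ψ (1# + x)) 1#)

  isPoly-Δ : ∀ d {l φ} → IsPoly (suc d) l φ → IsPoly d (- (ι (suc d) * l)) (Δ φ)
  isPoly-Δ zero {l} {φ} (ψ , c₀ , ψ≈l , φ≈) x = begin
    Δ φ x                                   ≈⟨ Δ-horner φ≈ x ⟩
    x * (ψ x - ψ (1# + x)) + (- 1#) * ψ (1# + x)
      ≈⟨ +-cong (*-congˡ (trans (+-cong (ψ≈l x) (-‿cong (ψ≈l (1# + x)))) (-‿inverseʳ l))) (*-congˡ (ψ≈l (1# + x))) ⟩
    x * 0# + (- 1#) * l                     ≈⟨ trans (+-congʳ (zeroʳ x)) (+-identityˡ _) ⟩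
    (- 1#) * l                              ≈⟨ -‿distribˡ-* 1# l ⟨
    - (1# * l)                              ≈⟨ -‿cong (*-congʳ (+-identityʳ 1#)) ⟨
    - (ι 1 * l)                             ∎
  isPoly-Δ (suc d) {l} (ψ , c₀ , ψ-poly , φ≈) =
    isPoly-resp (suc d)
      (isPoly-+ (suc d) (isPoly-mulX d (isPoly-Δ d ψ-poly)) (isPoly-scale (suc d) (- 1#) (isPoly-shift (suc d) 1# ψ-poly)))
      (λ x → sym (Δ-horner φ≈ x))
      (solve 3 (λ a l o → (:- (a :* l)) :+ (:- o) :* l := :- ((o :+ a) :* l)) refl (ι (suc d)) l 1#)

  -- Δⁿ-lead k d = (-1)ᵏ (d + 1) (d + 2) ⋯ (d + k)
  Δⁿ-lead : ℕ → ℕ → Carrier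
  Δⁿ-lead zero   d = 1#
  Δⁿ-lead (suc k) d = - (ι (suc d) * Δⁿ-lead k (suc d))

  Δⁿ-lead-≉0 : ∀ k d → ¬ (Δⁿ-lead k d ≈ 0#)
  Δⁿ-lead-≉0 zero   d = 1≉0
  Δⁿ-lead-≉0 (suc k) d = -‿≉0 (*-≉0 (ι-suc≉0 d) (Δⁿ-lead-≉0 k (suc d)))

  isPoly-Δⁿ : ∀ k d {l φ} → IsPoly (k ℕ.+ d) l φ → IsPoly d (Δⁿ-lead k d * l) (Δⁿ k φ)
  isPoly-Δⁿ zero   d {l} φ-poly = isPoly-resp d φ-poly (λ _ → refl) (sym (*-identityˡ l))
  isPoly-Δⁿ (suc k) d {l} {φ} φ-poly =
    isPoly-resp d (isPoly-Δ d (isPoly-Δⁿ k (suc d) (PE.subst (λ n → IsPoly n l φ) (PE.sym (ℕP.+-suc k d)) φ-poly)))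
      (λ _ → refl) (solve 3 (λ a b l → :- (a :* (b :* l)) := (:- (a :* b)) :* l) refl _ _ _)

  δ : (ℕ → Carrier) → ℕ → Carrier
  δ g t = g t - g (suc t)

  δⁿ : ℕ → (ℕ → Carrier) → ℕ → Carrier
  δⁿ zero   g = g
  δⁿ (suc k) g = δ (δⁿ k g)

  δⁿ-cong : ∀ k {g g′} → (∀ t → g t ≈ g′ t) → ∀ t → δⁿ k g t ≈ δⁿ k g′ t
  δⁿ-cong zero   g≈g′ t = g≈g′ t
  δⁿ-cong (suc k) g≈g′ t = +-cong (δⁿ-cong k g≈g′ t) (-‿cong (δⁿ-cong k g≈g′ (suc t)))

  δⁿ-sample : ∀ {φ} → Cong φ → ∀ x₀ k t → δⁿ k (λ t → φ (ι t + x₀)) t ≈ Δⁿ k φ (ι t + x₀)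
  δⁿ-sample φ-cong x₀ zero   t = refl
  δⁿ-sample φ-cong x₀ (suc k) t =
    +-cong (δⁿ-sample φ-cong x₀ k t) (-‿cong (trans (δⁿ-sample φ-cong x₀ k (suc t)) (Δⁿ-cong k φ-cong (+-assoc _ _ _))))

  δⁿ-samples : ∀ d {l φ} → IsPoly d l φ → ∀ x₀ t → δⁿ d (λ t → φ (ι t + x₀)) t ≈ Δⁿ-lead d 0 * l
  δⁿ-samples d {l} {φ} φ-poly x₀ t = trans (δⁿ-sample (isPoly-cong d φ-poly) x₀ d t)
    (isPoly-Δⁿ d 0 (PE.subst (λ n → IsPoly n l φ) (PE.sym (ℕP.+-identityʳ d)) φ-poly) (ι t + x₀))

  columnMatrix : ∀ {n} → (Fin n → ℕ → Carrier) → Matrix n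
  columnMatrix G i j = G i (toℕ j)

  det-subtract-next-column : ∀ {n} (G G′ : Fin n → ℕ → Carrier) p → suc p < n →
    (∀ i t → t ≢ p → G′ i t ≈ G i t) → (∀ i → G′ i p ≈ G i p - G i (suc p)) →
    det (columnMatrix G′) ≈ det (columnMatrix G)
  det-subtract-next-column G G′ p p+1<n G′≈G G′p≈ with adjacent-from-toℕ p p+1<n
  ... | u , v , a , u≡p , v≡p+1 = det-subtract-adjacent (columnMatrix G) (columnMatrix G′) a
    (λ i j j≢u → G′≈G i (toℕ j) (λ j≡p → j≢u (FP.toℕ-injective (PE.trans j≡p (PE.sym u≡p)))))
    (λ i → PE.subst₂ (λ x y → G′ i x ≈ G i x - G i y) (PE.sym u≡p) (PE.sym v≡p+1) (G′p≈ i))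

  -- Replacing, from left to right, each column t by its difference with column t + 1 keeps the determinant;
  -- after k such rounds column t holds δⁿ (k ⊓ (L ∸ t)), the cap L ∸ t accounting for the missing columns.
  module ColumnDifferences (L : ℕ) where

    differenced : ℕ → (ℕ → Carrier) → ℕ → Carrier
    differenced k g t = δⁿ (k ℕ.⊓ (L ∸ t)) g t

    differencedBelow : ℕ → ℕ → (ℕ → Carrier) → ℕ → Carrier
    differencedBelow k p g t = choose (t ℕ.<? p) (differenced (suc k) g t) (differenced k g t)

    differencedBelow-≢ : ∀ k p g t → t ≢ p → differencedBelow k (suc p) g t ≈ differencedBelow k p g t
    differencedBelow-≢ k p g t t≢p with t ℕ.<? p
    ... | yes t<p = choose-yes (t ℕ.<? suc p) _ _ (ℕP.m<n⇒m<1+n t<p)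
    ... | no  t≮p = choose-no (t ℕ.<? suc p) _ _ (λ t<p+1 → t≮p (ℕP.≤∧≢⇒< (ℕP.≤-pred t<p+1) t≢p))

    differencedBelow-at : ∀ k p g → differencedBelow k (suc p) g p ≈ differenced (suc k) g p
    differencedBelow-at k p g = choose-yes (p ℕ.<? suc p) _ _ ℕP.≤-refl

    differencedBelow-≥ : ∀ k p g t → p ≤ℕ t → differencedBelow k p g t ≈ differenced k g t
    differencedBelow-≥ k p g t p≤t = choose-no (t ℕ.<? p) _ _ (ℕP.≤⇒≯ p≤t)

    det-differencedBelow-suc : ∀ k p (G : Fin (suc L) → ℕ → Carrier) →
      det (columnMatrix (λ i → differencedBelow k (suc p) (G i))) ≈ det (columnMatrix (λ i → differencedBelow k p (G i)))
    det-differencedBelow-suc k p G with suc (k ℕ.+ p) ℕ.≤? L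
    ... | yes k+p<L = det-subtract-next-column _ _ p (ℕ.s≤s (ℕP.m+n≤o⇒n≤o k k+p+1≤L))
      (λ i t → differencedBelow-≢ k p (G i) t) λ i → begin
        differencedBelow k (suc p) (G i) p                     ≈⟨ differencedBelow-at k p (G i) ⟩
        δⁿ (suc k ℕ.⊓ (L ∸ p)) (G i) p                         ≡⟨ PE.cong (λ e → δⁿ e (G i) p) (capped (suc k) p k+p<L) ⟩
        δⁿ k (G i) p - δⁿ k (G i) (suc p)                      ≡⟨ PE.cong₂ (λ e e′ → δⁿ e (G i) p - δⁿ e′ (G i) (suc p))
                                                                     (PE.sym (capped k p (ℕP.<⇒≤ k+p<L))) (PE.sym (capped k (suc p) k+p+1≤L)) ⟩
        differenced k (G i) p - differenced k (G i) (suc p)    ≈⟨ +-cong (differencedBelow-≥ k p (G i) p ℕP.≤-refl)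
                                                                     (-‿cong (differencedBelow-≥ k p (G i) (suc p) (ℕP.n≤1+n p))) ⟨
        differencedBelow k p (G i) p - differencedBelow k p (G i) (suc p) ∎
      where
      k+p+1≤L : k ℕ.+ suc p ≤ℕ L
      k+p+1≤L = PE.subst (_≤ℕ L) (PE.sym (ℕP.+-suc k p)) k+p<L
      capped : ∀ j q → j ℕ.+ q ≤ℕ L → j ℕ.⊓ (L ∸ q) ≡ j
      capped j q j+q≤L = ℕP.m≤n⇒m⊓n≡m (ℕP.m+n≤o⇒m≤o∸n j j+q≤L)
    ... | no k+p≮L = det-cong λ i j → entry i (toℕ j)
      where
      saturated : suc k ℕ.⊓ (L ∸ p) ≡ k ℕ.⊓ (L ∸ p)
      saturated = PE.trans (ℕP.m≥n⇒m⊓n≡n (ℕP.m≤n⇒m≤1+n L∸p≤k)) (PE.sym (ℕP.m≥n⇒m⊓n≡n L∸p≤k))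
        where
        L∸p≤k : L ∸ p ≤ℕ k
        L∸p≤k = PE.subst (L ∸ p ≤ℕ_) (ℕP.m+n∸n≡m k p) (ℕP.∸-monoˡ-≤ p (ℕP.≤-pred (ℕP.≰⇒> k+p≮L)))
      entry : ∀ i t → differencedBelow k (suc p) (G i) t ≈ differencedBelow k p (G i) t
      entry i t with t ℕ.≟ p
      ... | no t≢p    = differencedBelow-≢ k p (G i) t t≢p
      ... | yes PE.refl = begin
        differencedBelow k (suc t) (G i) t   ≈⟨ differencedBelow-at k t (G i) ⟩
        differenced (suc k) (G i) t          ≡⟨ PE.cong (λ e → δⁿ e (G i) t) saturated ⟩
        differenced k (G i) t                ≈⟨ differencedBelow-≥ k t (G i) t ℕP.≤-refl ⟨
        differencedBelow k t (G i) t         ∎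

    det-differenced-suc : ∀ k (G : Fin (suc L) → ℕ → Carrier) →
      det (columnMatrix (λ i → differenced (suc k) (G i))) ≈ det (columnMatrix (λ i → differenced k (G i)))
    det-differenced-suc k G = trans (det-cong all-below) (sweep (suc L))
      where
      all-below : ∀ i j → differenced (suc k) (G i) (toℕ j) ≈ differencedBelow k (suc L) (G i) (toℕ j)
      all-below i j = sym (choose-yes (toℕ j ℕ.<? suc L) _ _ (FP.toℕ<n j))
      sweep : ∀ p → det (columnMatrix (λ i → differencedBelow k p (G i))) ≈ det (columnMatrix (λ i → differenced k (G i)))
      sweep zero   = det-cong λ i j → differencedBelow-≥ k 0 (G i) (toℕ j) ℕ.z≤n
      sweep (suc p) = trans (det-differencedBelow-suc k p G) (sweep p)

    det-differenced : ∀ k (G : Fin (suc L) → ℕ → Carrier) →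
      det (columnMatrix (λ i → differenced k (G i))) ≈ det (columnMatrix G)
    det-differenced zero   G = refl
    det-differenced (suc k) G = trans (det-differenced-suc k G) (det-differenced k G)

    det-fully-differenced : ∀ (G : Fin (suc L) → ℕ → Carrier) →
      det (λ i j → δⁿ (L ∸ toℕ j) (G i) (toℕ j)) ≈ det (columnMatrix G)
    det-fully-differenced G = trans
      (det-cong λ i j → reflexive (PE.cong (λ e → δⁿ e (G i) (toℕ j)) (PE.sym (ℕP.m≥n⇒m⊓n≡n (ℕP.m∸n≤m L (toℕ j))))))
      (det-differenced L G)

  -- Generalised Vandermonde: clear row 0 against the constant column 0, then divide row i by x i - x 0
  -- (factor theorem) to reach a matrix of the same shape with one point fewer.
  det-poly-columns-≉0 : ∀ n (x : Fin n → Carrier) (φ : Fin n → Carrier → Carrier) (l : Fin n → Carrier) →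
    (∀ i j → toℕ i < toℕ j → ¬ (x j - x i ≈ 0#)) → (∀ t → ¬ (l t ≈ 0#)) →
    (∀ t → IsPoly (toℕ t) (l t) (φ t)) → ¬ (det (λ i t → φ t (x i)) ≈ 0#)
  det-poly-columns-≉0 zero   x φ l x-distinct l≉0 φ-poly = 1≉0
  det-poly-columns-≉0 (suc n) x φ l x-distinct l≉0 φ-poly det≈0 =
    *-≉0 φ₀x₀≉0 (*-≉0 (Π-≉0 gap gap≉0) quotient≉0) (begin
      φ zero (x zero) * (Π gap * det N)                              ≈⟨ *-congˡ (det-scale-rows gap N) ⟨
      φ zero (x zero) * det (λ i k → gap i * N i k)                   ≈⟨ *-congˡ (det-cong (λ i k → sym (cleared-rest i k))) ⟩
      M′ zero zero * det (λ i k → M′ (suc i) (suc k))                 ≈⟨ det-row₀-head M′ cleared-row₀ ⟨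
      det M′                                                          ≈⟨ det-subtractColumn₀ M μ ⟩
      det M                                                           ≈⟨ det≈0 ⟩
      0#                                                              ∎)
    where
    M : Matrix (suc n)
    M i t = φ t (x i)
    l₀⁻¹ : Carrier
    l₀⁻¹ = proj₁ (inverse (l zero) (l≉0 zero))
    μ : Fin n → Carrier
    μ t = φ (suc t) (x zero) * l₀⁻¹
    M′ : Matrix (suc n)
    M′ = subtractColumn₀ M μ
    φ₀x₀≉0 : ¬ (φ zero (x zero) ≈ 0#)
    φ₀x₀≉0 e = l≉0 zero (trans (sym (φ-poly zero (x zero))) e)
    cancel : ∀ a y → (a * l₀⁻¹) * φ zero y ≈ a
    cancel a y = begin
      (a * l₀⁻¹) * φ zero y    ≈⟨ *-assoc a _ _ ⟩
      a * (l₀⁻¹ * φ zero y)    ≈⟨ *-congˡ (trans (*-congˡ (φ-poly zero y)) (*-comm _ _)) ⟩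
      a * (l zero * l₀⁻¹)      ≈⟨ *-congˡ (proj₂ (inverse (l zero) (l≉0 zero))) ⟩
      a * 1#                   ≈⟨ *-identityʳ a ⟩
      a                        ∎
    factor : ∀ k → ∃ λ χ → IsPoly (toℕ k) (l (suc k)) χ × (∀ y → φ (suc k) y - φ (suc k) (x zero) ≈ (y - x zero) * χ y)
    factor k = isPoly-factor (toℕ k) (φ-poly (suc k)) (x zero)
    N : Matrix n
    N i k = proj₁ (factor k) (x (suc i))
    gap : Fin n → Carrier
    gap i = x (suc i) - x zero
    gap≉0 : ∀ i → ¬ (gap i ≈ 0#)
    gap≉0 i = x-distinct zero (suc i) (ℕ.s≤s ℕ.z≤n)
    quotient≉0 : ¬ (det N ≈ 0#)
    quotient≉0 = det-poly-columns-≉0 n (x ∘ suc) (proj₁ ∘ factor) (l ∘ suc)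
      (λ i j i<j → x-distinct (suc i) (suc j) (ℕ.s≤s i<j)) (l≉0 ∘ suc) (proj₁ ∘ proj₂ ∘ factor)
    cleared-row₀ : ∀ j → M′ zero (suc j) ≈ 0#
    cleared-row₀ j = trans (+-congˡ (-‿cong (cancel _ _))) (-‿inverseʳ _)
    cleared-rest : ∀ i k → M′ (suc i) (suc k) ≈ gap i * N i k
    cleared-rest i k = trans (+-congˡ (-‿cong (cancel _ _))) (proj₂ (proj₂ (factor k)) (x (suc i)))

  degree-criterion : ∀ {ℓ} (q : Fin (suc ℓ) → Carrier) (D : ℕ → Carrier) →
    (∀ s → s ≤ℕ ℓ → (∀ k → ℓ ∸ s < toℕ k → q k ≈ 0#) → ∀ t → toℕ t ≡ ℓ ∸ s → (D s ≈ 0# ⇔ q t ≈ 0#)) →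
    ∀ m → m ≤ℕ ℓ → HasDegree q (ℓ ∸ m) ⇔ ((∀ s → s < m → D s ≈ 0#) × ¬ (D m ≈ 0#))
  degree-criterion {ℓ} q D D≈0⇔ m m≤ℓ = mk⇔
    (λ (q≉0 , q≈0) →
      (λ s s<m → Equivalence.from
         (D≈0⇔ s (s≤ℓ s<m) (above s<m q≈0) (index s) (index-toℕ s)) (q≈0 (index s) (below-index s<m)))
      , (λ Dm≈0 → q≉0 (index m) (index-toℕ m)
           (Equivalence.to (D≈0⇔ m m≤ℓ q≈0 (index m) (index-toℕ m)) Dm≈0)))
    (λ (D≈0 , Dm≉0) →
      (λ k k≡ℓ-m qk≈0 → Dm≉0 (Equivalence.from (D≈0⇔ m m≤ℓ (vanishing D≈0 m ℕP.≤-refl) k k≡ℓ-m) qk≈0))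
      , vanishing D≈0 m ℕP.≤-refl)
    where
    index : ∀ s → Fin (suc ℓ)
    index s = fromℕ< (ℕ.s≤s (ℕP.m∸n≤m ℓ s))
    index-toℕ : ∀ s → toℕ (index s) ≡ ℓ ∸ s
    index-toℕ s = FP.toℕ-fromℕ< _
    s≤ℓ : ∀ {s} → s < m → s ≤ℕ ℓ
    s≤ℓ s<m = ℕP.<⇒≤ (ℕP.<-≤-trans s<m m≤ℓ)
    above : ∀ {s} → s < m → (∀ k → ℓ ∸ m < toℕ k → q k ≈ 0#) → ∀ k → ℓ ∸ s < toℕ k → q k ≈ 0#
    above s<m q≈0 k ℓ-s<k = q≈0 k (ℕP.≤-<-trans (ℕP.∸-monoʳ-≤ ℓ (ℕP.<⇒≤ s<m)) ℓ-s<k)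
    below-index : ∀ {s} → s < m → ℓ ∸ m < toℕ (index s)
    below-index {s} s<m = PE.subst (ℓ ∸ m <_) (PE.sym (index-toℕ s)) (ℕP.∸-monoʳ-< s<m m≤ℓ)
    vanishing : (∀ s → s < m → D s ≈ 0#) → ∀ s → s ≤ℕ m → ∀ k → ℓ ∸ s < toℕ k → q k ≈ 0#
    vanishing D≈0 zero   _     k ℓ<k = ⊥-elim (ℕP.<-irrefl PE.refl (ℕP.<-≤-trans ℓ<k (ℕP.≤-pred (FP.toℕ<n k))))
    vanishing D≈0 (suc s) s<m k ℓ-s-1<k with toℕ k ℕ.≟ ℓ ∸ s
    ... | yes k≡ℓ-s = Equivalence.to
                        (D≈0⇔ s (s≤ℓ s<m) (vanishing D≈0 s (ℕP.<⇒≤ s<m)) k k≡ℓ-s) (D≈0 s s<m)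
    ... | no  k≢ℓ-s = vanishing D≈0 s (ℕP.<⇒≤ s<m) k
                        (ℕP.≤∧≢⇒< (PE.subst (_≤ℕ toℕ k) (PE.sym (ℕP.+-∸-assoc 1 (ℕP.<-≤-trans s<m m≤ℓ))) ℓ-s-1<k)
                                  (k≢ℓ-s ∘ PE.sym))

  module Interpolation (N : ℕ) (ξ h : Carrier) (a q : Fin (suc (suc N)) → Carrier)
                       (interpolates : ∀ i → eval q (ξ + ι (toℕ i) * h) ≈ a i) where

    ℓ : ℕ
    ℓ = suc N
    open ColumnDifferences ℓ

    Q : Carrier → Carrier
    Q y = eval q (ξ + y * h)

    Q-cong : Cong Q
    Q-cong {x} {y} x≈y = Σ-cong {f = λ k → q k * (ξ + x * h) ^ toℕ k} {g = λ k → q k * (ξ + y * h) ^ toℕ k}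
      λ k → *-congˡ (^-cong (toℕ k) (+-congˡ (*-congʳ x≈y)))

    P : Carrier → Carrier
    P y = y ^ N

    node : ℕ → Carrier
    node m = ι (m ℕ.* suc ℓ ℕ.+ 1)

    lastRow : ℕ → ℕ → Carrier
    lastRow s t = ι (t ℕ.^ s) * Q (ι t)

    upperRow : ℕ → ℕ → Carrier
    upperRow m t = ι ((m ℕ.* suc ℓ ℕ.+ t ℕ.+ 1) ℕ.^ (ℓ ∸ 1))

    rows : ℕ → Fin (suc ℓ) → ℕ → Carrier
    rows s i t = choose (toℕ i ℕ.≟ ℓ) (lastRow s t) (upperRow (toℕ i) t)

    A≈rows : ∀ s i j → A ℓ s a i j ≈ columnMatrix (rows s) i j
    A≈rows s i j with toℕ i ℕ.≟ ℓ
    ... | yes _ = *-congˡ (sym (interpolates j))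
    ... | no  _ = refl

    rows-last : ∀ s t → rows s (fromℕ ℓ) t ≈ lastRow s t
    rows-last s t = choose-yes (toℕ (fromℕ ℓ) ℕ.≟ ℓ) _ _ (FP.toℕ-fromℕ ℓ)

    rows-upper : ∀ s (i : Fin ℓ) t → rows s (inject₁ i) t ≈ upperRow (toℕ i) t
    rows-upper s i t = trans (choose-no (toℕ (inject₁ i) ℕ.≟ ℓ) _ _ (λ i≡ℓ → FP.toℕ-inject₁-≢ i (PE.sym i≡ℓ)))
                             (reflexive (PE.cong (λ m → upperRow m t) (FP.toℕ-inject₁ i)))

    δⁿ-upperRow : ∀ k m t → δⁿ k (upperRow m) t ≈ Δⁿ k P (ι t + node m)
    δⁿ-upperRow k m t = trans (δⁿ-cong k sample t) (δⁿ-sample (isPoly-cong N (isPoly-pow N)) (node m) k t)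
      where
      sample : ∀ t → upperRow m t ≈ P (ι t + node m)
      sample t = trans (ι-^ _ N) (^-cong N (trans (reflexive (PE.cong ι reorder)) (ι-+ t _)))
        where
        reorder : m ℕ.* suc ℓ ℕ.+ t ℕ.+ 1 ≡ t ℕ.+ (m ℕ.* suc ℓ ℕ.+ 1)
        reorder = PE.trans (PE.cong (ℕ._+ 1) (ℕP.+-comm (m ℕ.* suc ℓ) t)) (ℕP.+-assoc t _ 1)

    upperRow-δℓ≈0 : ∀ m → δⁿ ℓ (upperRow m) 0 ≈ 0#
    upperRow-δℓ≈0 m = trans (δⁿ-cong ℓ (λ t → δⁿ-upperRow 0 m t) 0)
      (trans (δⁿ-samples ℓ (isPoly-raise ℕP.≤-refl (isPoly-pow N)) (node m) 0) (zeroʳ _))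

    K : Carrier
    K = det {ℓ} (λ i k → δⁿ (N ∸ toℕ k) (upperRow (toℕ i)) (suc (toℕ k)))

    det-A : ∀ s → det (A ℓ s a) ≈ alt ℓ (δⁿ ℓ (lastRow s) 0 * K)
    det-A s = begin
      det (A ℓ s a)                       ≈⟨ det-cong (A≈rows s) ⟩
      det (columnMatrix (rows s))         ≈⟨ det-fully-differenced (rows s) ⟨
      det D
        ≈⟨ det-column₀-last ℓ D (λ i → trans (δⁿ-cong ℓ (rows-upper s i) 0) (upperRow-δℓ≈0 (toℕ i))) ⟩
      alt ℓ (D (fromℕ ℓ) zero * det (λ i k → D (inject₁ i) (suc k)))
        ≈⟨ alt-cong ℓ (*-cong (δⁿ-cong ℓ (rows-last s) 0)
                              (det-cong {M = λ i k → D (inject₁ i) (suc k)} (λ i k → δⁿ-cong (N ∸ toℕ k) (rows-upper s i) (suc (toℕ k))))) ⟩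
      alt ℓ (δⁿ ℓ (lastRow s) 0 * K)      ∎
      where
      D : Matrix (suc ℓ)
      D i j = δⁿ (ℓ ∸ toℕ j) (rows s i) (toℕ j)

    K≉0 : ¬ (K ≈ 0#)
    K≉0 K≈0 = det-poly-columns-≉0 ℓ (node ∘ toℕ) φ lead nodes-distinct lead≉0 φ-poly
      (trans (det-cong {M = λ i k → φ k (node (toℕ i))} (λ i k → sym (δⁿ-upperRow (N ∸ toℕ k) (toℕ i) (suc (toℕ k))))) K≈0)
      where
      φ : Fin ℓ → Carrier → Carrier
      φ k y = Δⁿ (N ∸ toℕ k) P (ι (suc (toℕ k)) + y)
      lead : Fin ℓ → Carrier
      lead k = Δⁿ-lead (N ∸ toℕ k) (toℕ k) * 1#
      lead≉0 : ∀ k → ¬ (lead k ≈ 0#)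
      lead≉0 k = *-≉0 (Δⁿ-lead-≉0 (N ∸ toℕ k) (toℕ k)) 1≉0
      φ-poly : ∀ k → IsPoly (toℕ k) (lead k) (φ k)
      φ-poly k = isPoly-shift (toℕ k) (ι (suc (toℕ k))) (isPoly-Δⁿ (N ∸ toℕ k) (toℕ k)
        (PE.subst (λ n → IsPoly n 1# P) (PE.sym (ℕP.m∸n+n≡m (ℕP.≤-pred (FP.toℕ<n k)))) (isPoly-pow N)))
      nodes-distinct : ∀ i j → toℕ i < toℕ j → ¬ (node (toℕ j) - node (toℕ i) ≈ 0#)
      nodes-distinct i j i<j = ι-diff≉0 (ℕP.+-monoˡ-< 1 (ℕP.*-monoˡ-< (suc ℓ) i<j))

    lastRow-δℓ : ∀ s → s ≤ℕ ℓ → (∀ k → ℓ ∸ s < toℕ k → q k ≈ 0#) → ∀ t → toℕ t ≡ ℓ ∸ s →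
      δⁿ ℓ (lastRow s) 0 ≈ Δⁿ-lead ℓ 0 * (q t * h ^ (ℓ ∸ s))
    lastRow-δℓ s s≤ℓ q≈0 t t≡ℓ-s =
      trans (δⁿ-cong ℓ sample 0) (δⁿ-samples ℓ F-poly 0# 0)
      where
      F : Carrier → Carrier
      F y = y ^ s * Q y
      F-poly : IsPoly ℓ (q t * h ^ (ℓ ∸ s)) F
      F-poly = PE.subst (λ n → IsPoly n (q t * h ^ (ℓ ∸ s)) F) (ℕP.m+[n∸m]≡n s≤ℓ)
        (isPoly-mulXs s (ℓ ∸ s) (isPoly-eval-affine q ξ h (ℓ ∸ s) t t≡ℓ-s q≈0))
      sample : ∀ t → lastRow s t ≈ F (ι t + 0#)
      sample t = *-cong (trans (ι-^ t s) (^-cong s (sym (+-identityʳ _)))) (Q-cong (sym (+-identityʳ _)))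

    det-A≈0⇔ : ¬ (h ≈ 0#) → ∀ s → s ≤ℕ ℓ → (∀ k → ℓ ∸ s < toℕ k → q k ≈ 0#) → ∀ t → toℕ t ≡ ℓ ∸ s →
      det (A ℓ s a) ≈ 0# ⇔ q t ≈ 0#
    det-A≈0⇔ h≉0 s s≤ℓ q≈0 t t≡ℓ-s = mk⇔
      (λ detA≈0 → *-cancelʳ-≉0 (^-≉0 (ℓ ∸ s) h≉0) (*-cancelˡ-≉0 (Δⁿ-lead-≉0 ℓ 0)
        (*-cancelʳ-≉0 K≉0 (alt≈0⇒≈0 ℓ (trans (sym det-A≈) detA≈0)))))
      (λ qt≈0 → trans det-A≈ (trans (alt-cong ℓ (product≈0 qt≈0)) (alt-0 ℓ)))
      where
      det-A≈ : det (A ℓ s a) ≈ alt ℓ ((Δⁿ-lead ℓ 0 * (q t * h ^ (ℓ ∸ s))) * K)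
      det-A≈ = trans (det-A s) (alt-cong ℓ (*-congʳ (lastRow-δℓ s s≤ℓ q≈0 t t≡ℓ-s)))
      product≈0 : q t ≈ 0# → (Δⁿ-lead ℓ 0 * (q t * h ^ (ℓ ∸ s))) * K ≈ 0#
      product≈0 qt≈0 = trans (*-congʳ (trans (*-congˡ (trans (*-congʳ qt≈0) (zeroˡ _))) (zeroʳ _))) (zeroˡ K)

theorem1 : ∀ {c r : Level} (R : RealField c r) →
    let open RealField R in
    let open RealDefs R in
    (ℓ : ℕ) → 1 ≤ℕ ℓ →
    (ξ h : Carrier) → ¬ (h ≈ 0#) →
    (a : Fin (suc ℓ) → Carrier) →
    (q : Fin (suc ℓ) → Carrier) →
    (∀ i → eval q (ξ + (ι (toℕ i) * h)) ≈ a i) →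
    (m : ℕ) → m ≤ℕ ℓ →
    (HasDegree q (ℓ ∸ m) ⇔
    ((∀ s → s < m → det (A ℓ s a) ≈ 0#) × ¬ (det (A ℓ m a) ≈ 0#)))
theorem1 R (suc N) _ ξ h h≉0 a q interpolates =
  degree-criterion R q _ (Interpolation.det-A≈0⇔ R N ξ h a q interpolates h≉0)
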